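{- Let $F$ be a nonbipartite graph with $n\ge 3$ vertices. Let $G_F=F\times K_2$ be the bipartite graph with adjacency matrix $\begin{pmatrix}0 & A_F\\ A_F & 0\end{pmatrix}$, and let $H_F=2F$ be the disjoint union of two copies of $F$, with adjacency matrix $\begin{pmatrix}A_F & 0\\ 0 & A_F\end{pmatrix}$. Then $G_F$ and $H_F$ are singularly cospectral but not cospectral (i.e. they form an NCSC pair).
   Context: All graphs are finite, without loops or multiple edges; $A_F$ is the adjacency matrix of $F$. Two graphs are cospectral if their adjacency matrices have the same spectrum (with multiplicities). The singular values of a graph are those of its adjacency matrix; two graphs are singularly cospectral if they have the same nonzero singular values with the same multiplicities. An NCSC pair is a pair of noncospectral singularly cospectral graphs. -}

module Defs where

open import Data.Nat using (ℕ; zero; suc; _+_; _≤_)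
open import Data.Nat.Base using (_^_)
open import Data.Integer as ℤ using (ℤ; +_; -_)
open import Data.Bool using (Bool; true; false; if_then_else_)
open import Data.Fin using (Fin; zero; suc; splitAt; punchIn; toℕ)
open import Data.Fin.Properties using (_≟_)
open import Data.List using (List; []; _∷_; map)
open import Data.Sum using (_⊎_; inj₁; inj₂)
open import Data.Product using (Σ; _×_; ∃; ∃-syntax)
open import Relation.Nullary using (¬_; yes; no)
open import Relation.Binary.PropositionalEquality using (_≡_; _≢_; refl)

record Graph (n : ℕ) : Set where
  field
    adj      : Fin n → Fin n → Bool
    sym      : ∀ i j → adj i j ≡ adj j i
    loopless : ∀ i → adj i i ≡ false
open Graph public

Bipartite : ∀ {n} → Graph n → Set
Bipartite {n} F = Σ (Fin n → Bool) λ c → ∀ i j → adj F i j ≡ true → c i ≢ c j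

NonBipartite : ∀ {n} → Graph n → Set
NonBipartite F = ¬ Bipartite F

Mat : ℕ → Set
Mat n = Fin n → Fin n → ℤ

adjMat : ∀ {n} → Graph n → Mat n
adjMat F i j = if adj F i j then + 1 else + 0

transpose : ∀ {n} → Mat n → Mat n
transpose A i j = A j i

sumℤ : ∀ {n} → (Fin n → ℤ) → ℤ
sumℤ {zero}  f = + 0
sumℤ {suc n} f = f zero ℤ.+ sumℤ (λ k → f (suc k))

_·_ : ∀ {n} → Mat n → Mat n → Mat n
(A · B) i j = sumℤ (λ k → A i k ℤ.* B k j)

-- Polynomials over ℤ as coefficient lists (lowest degree first)

Poly : Set
Poly = List ℤ

_+P_ : Poly → Poly → Poly
[]      +P q       = q
(a ∷ p) +P []      = a ∷ p
(a ∷ p) +P (b ∷ q) = (a ℤ.+ b) ∷ (p +P q)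

scal : ℤ → Poly → Poly
scal a p = map (a ℤ.*_) p

_*P_ : Poly → Poly → Poly
[]      *P q = []
(a ∷ p) *P q = scal a q +P (+ 0 ∷ (p *P q))

negP : Poly → Poly
negP = scal (- (+ 1))

constP : ℤ → Poly
constP a = a ∷ []

X : Poly
X = + 0 ∷ + 1 ∷ []

X^ : ℕ → Poly
X^ zero    = constP (+ 1)
X^ (suc k) = X *P X^ k

coeff : Poly → ℕ → ℤ
coeff []      k       = + 0
coeff (a ∷ p) zero    = a
coeff (a ∷ p) (suc k) = coeff p k

_≈P_ : Poly → Poly → Set
p ≈P q = ∀ k → coeff p k ≡ coeff q k

sumP : ∀ {n} → (Fin n → Poly) → Poly
sumP {zero}  f = []
sumP {suc n} f = f zero +P sumP (λ k → f (suc k))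

signP : ℕ → Poly → Poly
signP zero          p = p
signP (suc zero)    p = negP p
signP (suc (suc k)) p = signP k p

det : ∀ n → (Fin n → Fin n → Poly) → Poly
det zero    M = constP (+ 1)
det (suc n) M = sumP λ j →
  signP (toℕ j) (M zero j *P det n (λ i k → M (suc i) (punchIn j k)))

charPoly : ∀ {n} → Mat n → Poly
charPoly {n} A = det n λ i j →
  (if isYes (i ≟ j) then X else []) +P negP (constP (A i j))
  where
    isYes : ∀ {P : Set} → Relation.Nullary.Dec P → Bool
    isYes (yes _) = true
    isYes (no _)  = false

-- same spectrum with multiplicities  <=>  same characteristic polynomial
Cospectral : ∀ {m n} → Graph m → Graph n → Set
Cospectral G H = charPoly (adjMat G) ≈P charPoly (adjMat H)

-- same nonzero singular values with multiplicities: the squared singular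
-- values of A are the eigenvalues of AᵀA; equality of the nonzero ones
-- (with multiplicity) means the char. polys of AᵀA agree up to powers of x
SingularlyCospectral : ∀ {m n} → Graph m → Graph n → Set
SingularlyCospectral G H =
  ∃[ a ] ∃[ b ] ((X^ a *P charPoly (transpose AG · AG))
                 ≈P (X^ b *P charPoly (transpose AH · AH)))
  where
    AG = adjMat G
    AH = adjMat H

NCSC : ∀ {m n} → Graph m → Graph n → Set
NCSC G H = SingularlyCospectral G H × ¬ Cospectral G H

-- G_F = F × K₂ and H_F = 2F on vertex set Fin (n + n)
-- (first n vertices = first block, last n = second block)

module _ {n : ℕ} (F : Graph n) where
  private
    gA : Fin n ⊎ Fin n → Fin n ⊎ Fin n → Bool
    gA (inj₁ a) (inj₂ b) = adj F a b
    gA (inj₂ a) (inj₁ b) = adj F a b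
    gA (inj₁ a) (inj₁ b) = false
    gA (inj₂ a) (inj₂ b) = false

    gSym : ∀ x y → gA x y ≡ gA y x
    gSym (inj₁ a) (inj₁ b) = refl
    gSym (inj₁ a) (inj₂ b) = sym F a b
    gSym (inj₂ a) (inj₁ b) = sym F a b
    gSym (inj₂ a) (inj₂ b) = refl

    gLoop : ∀ x → gA x x ≡ false
    gLoop (inj₁ a) = refl
    gLoop (inj₂ a) = refl

    hA : Fin n ⊎ Fin n → Fin n ⊎ Fin n → Bool
    hA (inj₁ a) (inj₁ b) = adj F a b
    hA (inj₂ a) (inj₂ b) = adj F a b
    hA (inj₁ a) (inj₂ b) = false
    hA (inj₂ a) (inj₁ b) = false

    hSym : ∀ x y → hA x y ≡ hA y x
    hSym (inj₁ a) (inj₁ b) = sym F a b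
    hSym (inj₁ a) (inj₂ b) = refl
    hSym (inj₂ a) (inj₁ b) = refl
    hSym (inj₂ a) (inj₂ b) = sym F a b

    hLoop : ∀ x → hA x x ≡ false
    hLoop (inj₁ a) = loopless F a
    hLoop (inj₂ a) = loopless F a

  G[_] : Graph (n + n)
  G[_] = record
    { adj      = λ i j → gA (splitAt n i) (splitAt n j)
    ; sym      = λ i j → gSym (splitAt n i) (splitAt n j)
    ; loopless = λ i → gLoop (splitAt n i) }

  H[_] : Graph (n + n)
  H[_] = record
    { adj      = λ i j → hA (splitAt n i) (splitAt n j)
    ; sym      = λ i j → hSym (splitAt n i) (splitAt n j)
    ; loopless = λ i → hLoop (splitAt n i) }

-- Both graphs have the Gram matrix AᵀA = diag (A_F², A_F²): A_H is A_G with its two row blocks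
-- swapped, so they are singularly cospectral.
-- By the Leibniz expansion, the coefficient of x^(K - m) in det (xI - A) for a graph on K
-- vertices is a signed count of the permutations moving exactly m vertices, each along an edge.
-- A graph is bipartite iff all these coefficients vanish for odd m. In a bipartite graph every
-- closed walk is even, so every such permutation moves an even number of vertices. Conversely, if
-- some permutation moves an odd number of vertices along edges, one moving the least odd number m
-- is a single m-cycle, an even permutation; so all terms of that coefficient are -1 and it is
-- negative. Finally G_F is bipartite while H_F is not, since it contains F.
module Submission where

open import Defs renaming (sym to adj-sym)
open import Data.Bool using (Bool; true; false; if_then_else_; not)
import Data.Bool.Properties as Boolₚ
open Boolₚ using (not-involutive)
open import Data.Empty using (⊥-elim)
open import Data.Fin as Fin using (Fin; zero; suc; punchIn; punchOut; toℕ; _↑ˡ_; _↑ʳ_; splitAt; join)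
open import Data.Fin.Permutation.Components using (transpose-inverse) renaming (transpose to transposition)
import Data.Fin.Properties as Finₚ
open Finₚ using (_≟_; 0≢1+n; pigeonhole; toℕ<n; ¬∀⟶∃¬-smallest; toℕ-fromℕ<; toℕ-inject; suc-injective; punchIn-injective; punchInᵢ≢i; punchOut-injective; punchIn-punchOut; splitAt-↑ˡ; splitAt-↑ʳ; splitAt-join)
open import Data.Integer as ℤ using (ℤ; +_; -_; 0ℤ; 1ℤ; -1ℤ)
import Data.Integer.Properties as ℤₚ
open import Data.Integer.Solver using (module +-*-Solver)
open import Data.List using (List; []; _∷_; length; applyUpTo)
open import Data.List.Membership.Propositional using (_∈_; _∉_)
open import Data.List.Relation.Unary.All using (All; []; _∷_)
open import Data.List.Relation.Unary.All.Properties using (All¬⇒¬Any; ¬Any⇒All¬)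
open import Data.List.Relation.Unary.Any using (Any; here; there; any?)
open import Data.List.Relation.Unary.Unique.Propositional using (Unique; []; _∷_)
open import Data.List.Relation.Unary.Unique.Propositional.Properties using (applyUpTo⁺₁)
open import Data.List.Membership.Propositional.Properties using (∈-applyUpTo⁺; ∈-applyUpTo⁻)
open import Data.List.Properties using (length-applyUpTo)
open import Data.Nat as ℕ using (ℕ; zero; suc; _<_; _≤_; z≤n; s≤s; parity)
import Data.Nat.Properties as ℕₚ
open import Data.Parity as ℙ using (Parity; 0ℙ; 1ℙ)
import Data.Parity.Properties as Parityₚ
open import Data.Nat.Induction using (<-rec)
open import Data.Product using (Σ; ∃; ∃₂; ∃-syntax; _×_; _,_; proj₁; proj₂)
open import Data.Sum as Sum using (_⊎_; inj₁; inj₂)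
open import Data.Unit using (⊤; tt)
open import Function using (_∘_; id)
open import Function.Definitions using (Injective)
open import Relation.Nullary using (Dec; yes; no; does; ¬_)
open import Relation.Nullary.Decidable using (dec-true; dec-false; ¬?; decidable-stable; _×-dec_; _→-dec_)
open import Relation.Binary.PropositionalEquality
import Algebra.Properties.CommutativeSemigroup as CommSemigroupProperties

private
  module ℕ+ = CommSemigroupProperties ℕₚ.+-commutativeSemigroup
  module ℤ* = CommSemigroupProperties ℤₚ.*-commutativeSemigroup

bit : Bool → ℕ
bit b = if b then 1 else 0

count : ∀ {n} → (Fin n → Bool) → ℕ
count {zero}  f = 0
count {suc n} f = bit (f zero) ℕ.+ count (f ∘ suc)

prodℤ : ∀ {n} → (Fin n → ℤ) → ℤ
prodℤ {zero}  f = 1ℤ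
prodℤ {suc n} f = f zero ℤ.* prodℤ (f ∘ suc)

count-cong : ∀ {n} {f g : Fin n → Bool} → (∀ i → f i ≡ g i) → count f ≡ count g
count-cong {zero}  f≗g = refl
count-cong {suc n} f≗g = cong₂ ℕ._+_ (cong bit (f≗g zero)) (count-cong (f≗g ∘ suc))

count-false : ∀ {n} (f : Fin n → Bool) → (∀ i → f i ≡ false) → count f ≡ 0
count-false {zero}  f f≡false = refl
count-false {suc n} f f≡false rewrite f≡false zero = count-false (f ∘ suc) (f≡false ∘ suc)

count≢0⇒true : ∀ {n} (f : Fin n → Bool) → count f ≢ 0 → ∃[ i ] f i ≡ true
count≢0⇒true {zero}  f count≢0 = ⊥-elim (count≢0 refl)
count≢0⇒true {suc n} f count≢0 with f zero in f0
... | true  = zero , f0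
... | false with i , fi ← count≢0⇒true (f ∘ suc) count≢0 = suc i , fi

count≡0⇒false : ∀ {n} (f : Fin n → Bool) → count f ≡ 0 → ∀ i → f i ≡ false
count≡0⇒false {suc n} f none i with f zero in f0
count≡0⇒false {suc n} f none zero    | false = f0
count≡0⇒false {suc n} f none (suc i) | false = count≡0⇒false (f ∘ suc) none i

count-+ : ∀ {n} (f g h : Fin n → Bool) → (∀ i → bit (f i) ≡ bit (g i) ℕ.+ bit (h i)) →
          count f ≡ count g ℕ.+ count h
count-+ {zero}  f g h split = refl
count-+ {suc n} f g h split rewrite split zero | count-+ (f ∘ suc) (g ∘ suc) (h ∘ suc) (split ∘ suc) =
  ℕ+.interchange (bit (g zero)) (bit (h zero)) (count (g ∘ suc)) (count (h ∘ suc))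

count-punchIn : ∀ {n} (j : Fin (suc n)) (f : Fin (suc n) → Bool) →
                count f ≡ bit (f j) ℕ.+ count (f ∘ punchIn j)
count-punchIn         zero    f = refl
count-punchIn {suc n} (suc j) f = begin
  bit (f zero) ℕ.+ count (f ∘ suc)                                ≡⟨ cong (bit (f zero) ℕ.+_) (count-punchIn j (f ∘ suc)) ⟩
  bit (f zero) ℕ.+ (bit (f (suc j)) ℕ.+ count (f ∘ suc ∘ punchIn j)) ≡⟨ ℕ+.x∙yz≈y∙xz (bit (f zero)) (bit (f (suc j))) _ ⟩
  bit (f (suc j)) ℕ.+ count (f ∘ punchIn (suc j))                 ∎
  where open ≡-Reasoning

count-complement : ∀ {n} (f : Fin n → Bool) → count f ℕ.+ count (not ∘ f) ≡ n
count-complement {zero}  f = refl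
count-complement {suc n} f with f zero
... | true  = cong suc (count-complement (f ∘ suc))
... | false = trans (ℕₚ.+-suc (count (f ∘ suc)) _) (cong suc (count-complement (f ∘ suc)))

count≤ : ∀ {n} (f : Fin n → Bool) → count f ≤ n
count≤ {zero}  f = z≤n
count≤ {suc n} f with f zero
... | true  = s≤s (count≤ (f ∘ suc))
... | false = ℕₚ.m≤n⇒m≤1+n (count≤ (f ∘ suc))

least : ∀ {n} {P : Fin n → Set} → (∀ x → Dec (P x)) → ∀ {x} → P x → ∃ λ y → P y × ∀ {z} → P z → y Fin.≤ z
least {suc n} P? {x} px with P? zero
... | yes p0 = zero , p0 , λ _ → z≤n
... | no ¬p0 with x | px
...   | zero  | p = ⊥-elim (¬p0 p)
...   | suc _ | p with least (P? ∘ suc) p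
...     | y , py , minimal = suc y , py , λ { {zero} pz → ⊥-elim (¬p0 pz) ; {suc z} pz → s≤s (minimal pz) }

prodℤ-zero : ∀ {n} (f : Fin n → ℤ) i → f i ≡ 0ℤ → prodℤ f ≡ 0ℤ
prodℤ-zero f zero    f0≡0 rewrite f0≡0 = refl
prodℤ-zero f (suc i) fi≡0 rewrite prodℤ-zero (f ∘ suc) i fi≡0 = ℤₚ.*-zeroʳ (f zero)

prodℤ-signs : ∀ {n} (b : Fin n → Bool) → prodℤ (λ i → if b i then 1ℤ else -1ℤ) ≡ -1ℤ ℤ.^ count (not ∘ b)
prodℤ-signs {zero}  b = refl
prodℤ-signs {suc n} b with b zero
... | true  = trans (ℤₚ.*-identityˡ _) (prodℤ-signs (b ∘ suc))
... | false = cong (-1ℤ ℤ.*_) (prodℤ-signs (b ∘ suc))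

sumℤ-cong : ∀ {n} {f g : Fin n → ℤ} → (∀ i → f i ≡ g i) → sumℤ f ≡ sumℤ g
sumℤ-cong {zero}  f≗g = refl
sumℤ-cong {suc n} f≗g = cong₂ ℤ._+_ (f≗g zero) (sumℤ-cong (f≗g ∘ suc))

*-distribˡ-sumℤ : ∀ {n} x (f : Fin n → ℤ) → x ℤ.* sumℤ f ≡ sumℤ (λ i → x ℤ.* f i)
*-distribˡ-sumℤ {zero}  x f = ℤₚ.*-zeroʳ x
*-distribˡ-sumℤ {suc n} x f =
  trans (ℤₚ.*-distribˡ-+ x (f zero) _) (cong (λ s → x ℤ.* f zero ℤ.+ s) (*-distribˡ-sumℤ x (f ∘ suc)))

sumℤ-zero : ∀ {n} (f : Fin n → ℤ) → (∀ i → f i ≡ 0ℤ) → sumℤ f ≡ 0ℤ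
sumℤ-zero {zero}  f f≡0 = refl
sumℤ-zero {suc n} f f≡0 rewrite f≡0 zero = trans (ℤₚ.+-identityˡ _) (sumℤ-zero (f ∘ suc) (f≡0 ∘ suc))

sumℤ-nonpositive : ∀ {n} (f : Fin n → ℤ) → (∀ i → f i ℤ.≤ 0ℤ) → sumℤ f ℤ.≤ 0ℤ
sumℤ-nonpositive {zero}  f f≤0 = ℤₚ.≤-refl
sumℤ-nonpositive {suc n} f f≤0 = ℤₚ.+-mono-≤ (f≤0 zero) (sumℤ-nonpositive (f ∘ suc) (f≤0 ∘ suc))

sumℤ-negative : ∀ {n} (f : Fin n → ℤ) → (∀ i → f i ℤ.≤ 0ℤ) → ∀ i → f i ℤ.< 0ℤ → sumℤ f ℤ.< 0ℤ
sumℤ-negative {suc n} f f≤0 zero    f0<0 = ℤₚ.+-mono-<-≤ f0<0 (sumℤ-nonpositive (f ∘ suc) (f≤0 ∘ suc))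
sumℤ-negative {suc n} f f≤0 (suc i) fi<0 = ℤₚ.+-mono-≤-< (f≤0 zero) (sumℤ-negative (f ∘ suc) (f≤0 ∘ suc) i fi<0)

sumℤ-++ : ∀ m n (f : Fin (m ℕ.+ n) → ℤ) →
          sumℤ f ≡ sumℤ (λ i → f (i ↑ˡ n)) ℤ.+ sumℤ (λ i → f (m ↑ʳ i))
sumℤ-++ zero    n f = sym (ℤₚ.+-identityˡ _)
sumℤ-++ (suc m) n f =
  trans (cong (λ s → f zero ℤ.+ s) (sumℤ-++ m n (f ∘ suc))) (sym (ℤₚ.+-assoc (f zero) _ _))

-1^-suc : ∀ m → -1ℤ ℤ.^ suc m ≡ - (-1ℤ ℤ.^ m)
-1^-suc m = ℤₚ.-1*i≡-i (-1ℤ ℤ.^ m)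

-1^-2+ : ∀ m → -1ℤ ℤ.^ suc (suc m) ≡ -1ℤ ℤ.^ m
-1^-2+ m = trans (sym (ℤₚ.*-assoc -1ℤ -1ℤ _)) (ℤₚ.*-identityˡ _)

-1^-even : ∀ m → parity m ≡ 0ℙ → -1ℤ ℤ.^ m ≡ 1ℤ
-1^-even zero          _    = refl
-1^-even (suc zero)    ()
-1^-even (suc (suc m)) even = trans (-1^-2+ m) (-1^-even m even)

-1^-odd : ∀ m → parity m ≡ 1ℙ → -1ℤ ℤ.^ m ≡ -1ℤ
-1^-odd zero          ()
-1^-odd (suc zero)    _   = refl
-1^-odd (suc (suc m)) odd = trans (-1^-2+ m) (-1^-odd m odd)

-1^-square : ∀ m → -1ℤ ℤ.^ m ℤ.* -1ℤ ℤ.^ m ≡ 1ℤ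
-1^-square zero    = refl
-1^-square (suc m) = trans (square-neg (-1ℤ ℤ.^ m)) (-1^-square m)
  where
    open +-*-Solver
    square-neg : ∀ x → (-1ℤ ℤ.* x) ℤ.* (-1ℤ ℤ.* x) ≡ x ℤ.* x
    square-neg = solve 1 (λ x → (con -1ℤ :* x) :* (con -1ℤ :* x) := x :* x) refl

parity-suc : ∀ m → parity (suc m) ≡ parity m ℙ.⁻¹
parity-suc m = sym (Parityₚ.⁻¹-selfInverse (Parityₚ.suc-homo-⁻¹ m))

coeff-+P : ∀ p q k → coeff (p +P q) k ≡ coeff p k ℤ.+ coeff q k
coeff-+P []      q       k       = sym (ℤₚ.+-identityˡ _)
coeff-+P (a ∷ p) []      k       = sym (ℤₚ.+-identityʳ _)
coeff-+P (a ∷ p) (b ∷ q) zero    = refl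
coeff-+P (a ∷ p) (b ∷ q) (suc k) = coeff-+P p q k

coeff-scal : ∀ a p k → coeff (scal a p) k ≡ a ℤ.* coeff p k
coeff-scal a []      k       = sym (ℤₚ.*-zeroʳ a)
coeff-scal a (b ∷ p) zero    = refl
coeff-scal a (b ∷ p) (suc k) = coeff-scal a p k

coeff-signP : ∀ m p k → coeff (signP m p) k ≡ -1ℤ ℤ.^ m ℤ.* coeff p k
coeff-signP zero          p k = sym (ℤₚ.*-identityˡ _)
coeff-signP (suc zero)    p k = coeff-scal -1ℤ p k
coeff-signP (suc (suc m)) p k = trans (coeff-signP m p k) (cong (ℤ._* coeff p k) (sym (-1^-2+ m)))

coeff-sumP : ∀ {n} (f : Fin n → Poly) k → coeff (sumP f) k ≡ sumℤ (λ j → coeff (f j) k)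
coeff-sumP {zero}  f k = refl
coeff-sumP {suc n} f k = trans (coeff-+P (f zero) _ k) (cong (λ s → coeff (f zero) k ℤ.+ s) (coeff-sumP (f ∘ suc) k))

det-cong : ∀ n {M M′ : Fin n → Fin n → Poly} → (∀ i j → M i j ≡ M′ i j) → det n M ≡ det n M′
det-cong zero    M≗M′ = refl
det-cong (suc n) M≗M′ = sumP-cong λ j →
  cong₂ (λ a b → signP (toℕ j) (a *P b)) (M≗M′ zero j) (det-cong n (λ i k → M≗M′ (suc i) (punchIn j k)))
  where
    sumP-cong : ∀ {n} {f g : Fin n → Poly} → (∀ j → f j ≡ g j) → sumP f ≡ sumP g
    sumP-cong {zero}  f≗g = refl
    sumP-cong {suc n} f≗g = cong₂ _+P_ (f≗g zero) (sumP-cong (f≗g ∘ suc))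

charPolyMatrix : ∀ {K} → Mat K → Fin K → Fin K → Poly
charPolyMatrix A i j = (if does (i ≟ j) then X else []) +P negP (constP (A i j))

charPoly≡det : ∀ {K} (A : Mat K) → charPoly A ≡ det K (charPolyMatrix A)
charPoly≡det {K} A = trans (proj₂ unfolded) (det-cong K λ i j →
  cong (λ b → (if b then X else []) +P negP (constP (A i j))) (diagonalTest i j))
  where
    -- Defs tests the diagonal with a private helper; unification names it here.
    unfolded : Σ (Fin K → Fin K → Bool) λ d →
               charPoly A ≡ det K (λ i j → (if d i j then X else []) +P negP (constP (A i j)))
    unfolded = _ , refl
    diagonalTest : ∀ u v → proj₁ unfolded u v ≡ does (u ≟ v)
    diagonalTest u v with u ≟ v
    ... | yes _ = refl
    ... | no  _ = refl

charPoly-cong : ∀ {K} {A B : Mat K} → (∀ i j → A i j ≡ B i j) → charPoly A ≡ charPoly B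
charPoly-cong {K} {A} {B} A≗B = begin
  charPoly A               ≡⟨ charPoly≡det A ⟩
  det K (charPolyMatrix A) ≡⟨ det-cong K (λ i j → cong (λ a → _ +P negP (constP a)) (A≗B i j)) ⟩
  det K (charPolyMatrix B) ≡⟨ charPoly≡det B ⟨
  charPoly B               ∎
  where open ≡-Reasoning

-- Lehmer codes and the sign of a permutation

Code : ℕ → Set
Code zero    = ⊤
Code (suc n) = Fin (suc n) × Code n

-- A Lehmer-style code: the image of 0, then the code of the rest with that value punched out.
decode : ∀ {n} → Code n → Fin n → Fin n
decode (j , c) zero    = j
decode (j , c) (suc i) = punchIn j (decode c i)

codeSign : ∀ {n} → Code n → ℤ
codeSign {zero}  _       = 1ℤ
codeSign {suc n} (j , c) = -1ℤ ℤ.^ toℕ j ℤ.* codeSign c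

idCode : ∀ {n} → Code n
idCode {zero}  = tt
idCode {suc n} = zero , idCode

decode-idCode : ∀ {n} (i : Fin n) → decode idCode i ≡ i
decode-idCode zero    = refl
decode-idCode (suc i) = cong suc (decode-idCode i)

decode-injective : ∀ {n} (c : Code n) → Injective _≡_ _≡_ (decode c)
decode-injective (j , c) {zero}  {zero}  _  = refl
decode-injective (j , c) {zero}  {suc y} eq = ⊥-elim (punchInᵢ≢i j (decode c y) (sym eq))
decode-injective (j , c) {suc x} {zero}  eq = ⊥-elim (punchInᵢ≢i j (decode c x) eq)
decode-injective (j , c) {suc x} {suc y} eq =
  cong suc (decode-injective c (punchIn-injective j _ _ eq))

encode : ∀ {n} (π : Fin n → Fin n) → Injective _≡_ _≡_ π → Σ (Code n) λ c → ∀ i → decode c i ≡ π i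
encode {zero}  π π-inj = tt , λ ()
encode {suc n} π π-inj = (π zero , proj₁ tail) , decodes
  where
    π0≢π1+ : ∀ i → π zero ≢ π (suc i)
    π0≢π1+ i eq with π-inj eq
    ... | ()
    π′ : Fin n → Fin n
    π′ i = punchOut (π0≢π1+ i)
    tail = encode π′ λ eq → suc-injective (π-inj (punchOut-injective (π0≢π1+ _) (π0≢π1+ _) eq))
    decodes : ∀ i → decode (π zero , proj₁ tail) i ≡ π i
    decodes zero    = refl
    decodes (suc i) = trans (cong (punchIn (π zero)) (proj₂ tail i)) (punchIn-punchOut (π0≢π1+ i))

count-∘-decode : ∀ {n} (c : Code n) (f : Fin n → Bool) → count (f ∘ decode c) ≡ count f
count-∘-decode {zero}  c       f = refl
count-∘-decode {suc n} (j , c) f =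
  trans (cong (bit (f j) ℕ.+_) (count-∘-decode c (f ∘ punchIn j))) (sym (count-punchIn j f))

sumCode : ∀ {n} → (Code n → ℤ) → ℤ
sumCode {zero}  f = f tt
sumCode {suc n} f = sumℤ λ j → sumCode λ c → f (j , c)

sumCode-cong : ∀ {n} {f g : Code n → ℤ} → (∀ c → f c ≡ g c) → sumCode f ≡ sumCode g
sumCode-cong {zero}  f≗g = f≗g tt
sumCode-cong {suc n} f≗g = sumℤ-cong λ j → sumCode-cong λ c → f≗g (j , c)

*-distribˡ-sumCode : ∀ {n} x (f : Code n → ℤ) → x ℤ.* sumCode f ≡ sumCode (λ c → x ℤ.* f c)
*-distribˡ-sumCode {zero}  x f = refl
*-distribˡ-sumCode {suc n} x f =
  trans (*-distribˡ-sumℤ x (λ j → sumCode λ c → f (j , c))) (sumℤ-cong λ j → *-distribˡ-sumCode x λ c → f (j , c))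

sumCode-zero : ∀ {n} (f : Code n → ℤ) → (∀ c → f c ≡ 0ℤ) → sumCode f ≡ 0ℤ
sumCode-zero {zero}  f f≡0 = f≡0 tt
sumCode-zero {suc n} f f≡0 = sumℤ-zero (λ j → sumCode λ c → f (j , c)) λ j → sumCode-zero _ λ c → f≡0 (j , c)

sumCode-nonpositive : ∀ {n} (f : Code n → ℤ) → (∀ c → f c ℤ.≤ 0ℤ) → sumCode f ℤ.≤ 0ℤ
sumCode-nonpositive {zero}  f f≤0 = f≤0 tt
sumCode-nonpositive {suc n} f f≤0 = sumℤ-nonpositive (λ j → sumCode λ c → f (j , c)) λ j → sumCode-nonpositive _ λ c → f≤0 (j , c)

sumCode-negative : ∀ {n} (f : Code n → ℤ) → (∀ c → f c ℤ.≤ 0ℤ) → ∀ c → f c ℤ.< 0ℤ → sumCode f ℤ.< 0ℤ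
sumCode-negative {zero}  f f≤0 c       fc<0 = fc<0
sumCode-negative {suc n} f f≤0 (j , c) fc<0 =
  sumℤ-negative (λ i → sumCode λ c → f (i , c)) (λ i → sumCode-nonpositive _ λ c → f≤0 (i , c)) j
    (sumCode-negative (λ c → f (j , c)) (λ c → f≤0 (j , c)) c fc<0)

infix 5 _<ᵇ_
_<ᵇ_ : ∀ {n} → Fin n → Fin n → Bool
zero  <ᵇ zero  = false
zero  <ᵇ suc _ = true
suc _ <ᵇ zero  = false
suc a <ᵇ suc b = a <ᵇ b

<ᵇ-asym : ∀ {n} {a b : Fin n} → a ≢ b → a <ᵇ b ≡ not (b <ᵇ a)
<ᵇ-asym {a = zero}  {zero}  a≢b = ⊥-elim (a≢b refl)
<ᵇ-asym {a = zero}  {suc b} a≢b = refl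
<ᵇ-asym {a = suc a} {zero}  a≢b = refl
<ᵇ-asym {a = suc a} {suc b} a≢b = <ᵇ-asym (a≢b ∘ cong suc)

inversions : ∀ {n k} → (Fin n → Fin k) → ℕ
inversions {zero}  π = 0
inversions {suc n} π = count (λ i → π (suc i) <ᵇ π zero) ℕ.+ inversions (π ∘ suc)

sign : ∀ {n k} → (Fin n → Fin k) → ℤ
sign π = -1ℤ ℤ.^ inversions π

inversions-cong : ∀ {n k} {π π′ : Fin n → Fin k} → (∀ i → π i ≡ π′ i) → inversions π ≡ inversions π′
inversions-cong {zero}  π≗π′ = refl
inversions-cong {suc n} π≗π′ =
  cong₂ ℕ._+_ (count-cong λ i → cong₂ _<ᵇ_ (π≗π′ (suc i)) (π≗π′ zero)) (inversions-cong (π≗π′ ∘ suc))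

sign-cong : ∀ {n k} {π π′ : Fin n → Fin k} → (∀ i → π i ≡ π′ i) → sign π ≡ sign π′
sign-cong = cong (-1ℤ ℤ.^_) ∘ inversions-cong

inversions-suc∘ : ∀ {n k} (π : Fin n → Fin k) → inversions (Fin.suc ∘ π) ≡ inversions π
inversions-suc∘ {zero}  π = refl
inversions-suc∘ {suc n} π = cong (count (λ i → π (suc i) <ᵇ π zero) ℕ.+_) (inversions-suc∘ (π ∘ suc))

inversions-id : ∀ {n} → inversions (id {A = Fin n}) ≡ 0
inversions-id {zero}  = refl
inversions-id {suc n} =
  cong₂ ℕ._+_ (count-false (λ (i : Fin n) → Fin.suc i <ᵇ zero) λ _ → refl) (trans (inversions-suc∘ {k = n} id) (inversions-id {n}))

sign-suc : ∀ {n k} (τ : Fin (suc n) → Fin k) →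
           sign τ ≡ -1ℤ ℤ.^ count (λ i → τ (suc i) <ᵇ τ zero) ℤ.* sign (τ ∘ suc)
sign-suc τ = ℤₚ.^-distribˡ-+-* -1ℤ (count (λ i → τ (suc i) <ᵇ τ zero)) (inversions (τ ∘ suc))

swap01 : ∀ {n} → Fin (suc (suc n)) → Fin (suc (suc n))
swap01 zero          = suc zero
swap01 (suc zero)    = zero
swap01 (suc (suc i)) = suc (suc i)

sign-∘-swap01 : ∀ {n k} (τ : Fin (suc (suc n)) → Fin k) → τ zero ≢ τ (suc zero) → sign (τ ∘ swap01) ≡ - sign τ
sign-∘-swap01 τ τ0≢τ1 with τ zero <ᵇ τ (suc zero) in τ0<τ1
... | true rewrite <ᵇ-asym (τ0≢τ1 ∘ sym) | τ0<τ1 = begin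
  -1ℤ ℤ.^ suc (a ℕ.+ (b ℕ.+ r)) ≡⟨ -1^-suc (a ℕ.+ (b ℕ.+ r)) ⟩
  - (-1ℤ ℤ.^ (a ℕ.+ (b ℕ.+ r))) ≡⟨ cong (λ m → - (-1ℤ ℤ.^ m)) (ℕ+.x∙yz≈y∙xz a b r) ⟩
  - (-1ℤ ℤ.^ (b ℕ.+ (a ℕ.+ r))) ∎
  where
    open ≡-Reasoning
    a = count (λ i → τ (suc (suc i)) <ᵇ τ (suc zero))
    b = count (λ i → τ (suc (suc i)) <ᵇ τ zero)
    r = inversions (τ ∘ Fin.suc ∘ Fin.suc)
... | false rewrite <ᵇ-asym (τ0≢τ1 ∘ sym) | τ0<τ1 = begin
  -1ℤ ℤ.^ (a ℕ.+ (b ℕ.+ r))           ≡⟨ cong (-1ℤ ℤ.^_) (ℕ+.x∙yz≈y∙xz a b r) ⟩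
  -1ℤ ℤ.^ (b ℕ.+ (a ℕ.+ r))           ≡⟨ ℤₚ.neg-involutive _ ⟨
  - - (-1ℤ ℤ.^ (b ℕ.+ (a ℕ.+ r)))     ≡⟨ cong -_ (-1^-suc (b ℕ.+ (a ℕ.+ r))) ⟨
  - (-1ℤ ℤ.^ suc (b ℕ.+ (a ℕ.+ r)))   ∎
  where
    open ≡-Reasoning
    a = count (λ i → τ (suc (suc i)) <ᵇ τ (suc zero))
    b = count (λ i → τ (suc (suc i)) <ᵇ τ zero)
    r = inversions (τ ∘ Fin.suc ∘ Fin.suc)

sign-∘-lift-decode : ∀ {n k} (τ : Fin (suc n) → Fin k) (c : Code n) →
                     sign (τ ∘ Fin.lift 1 (decode c)) ≡
                     -1ℤ ℤ.^ count (λ i → τ (suc i) <ᵇ τ zero) ℤ.* sign (τ ∘ suc ∘ decode c)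
sign-∘-lift-decode τ c = trans (sign-suc (τ ∘ Fin.lift 1 (decode c)))
  (cong (λ m → -1ℤ ℤ.^ m ℤ.* sign (τ ∘ suc ∘ decode c)) (count-∘-decode c λ i → τ (suc i) <ᵇ τ zero))

-- The permutation sending 0 to j and keeping the order of the other points.
headTo : ∀ {n} → Fin (suc n) → Fin (suc n) → Fin (suc n)
headTo j = decode (j , idCode)

sign-∘-headTo : ∀ {n k} (τ : Fin (suc n) → Fin k) → Injective _≡_ _≡_ τ →
                ∀ j → sign (τ ∘ headTo j) ≡ -1ℤ ℤ.^ toℕ j ℤ.* sign τ
sign-∘-headTo τ τ-inj zero =
  trans (sign-cong {π = τ ∘ headTo zero} {π′ = τ} λ { zero → refl ; (suc i) → cong (τ ∘ suc) (decode-idCode i) }) (sym (ℤₚ.*-identityˡ _))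
sign-∘-headTo {suc n} τ τ-inj (suc j) = begin
  sign (τ ∘ headTo (suc j))                     ≡⟨ sign-cong {π = τ ∘ headTo (suc j)} {π′ = τ′ ∘ swap01} (λ { zero → refl ; (suc zero) → refl ; (suc (suc i)) → refl }) ⟩
  sign (τ′ ∘ swap01)                            ≡⟨ sign-∘-swap01 τ′ (0≢1+n ∘ τ-inj) ⟩
  - sign τ′                                     ≡⟨ cong -_ (sign-∘-lift-decode τ (j , idCode)) ⟩
  - (s₀ ℤ.* sign (τ ∘ suc ∘ headTo j))          ≡⟨ cong (λ x → - (s₀ ℤ.* x)) (sign-∘-headTo (τ ∘ suc) (suc-injective ∘ τ-inj) j) ⟩
  - (s₀ ℤ.* (-1ℤ ℤ.^ toℕ j ℤ.* sign (τ ∘ suc))) ≡⟨ rearrange s₀ (-1ℤ ℤ.^ toℕ j) (sign (τ ∘ suc)) ⟩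
  -1ℤ ℤ.^ toℕ (suc j) ℤ.* (s₀ ℤ.* sign (τ ∘ suc)) ≡⟨ cong (-1ℤ ℤ.^ toℕ (suc j) ℤ.*_) (sign-suc τ) ⟨
  -1ℤ ℤ.^ toℕ (suc j) ℤ.* sign τ                ∎
  where
    open ≡-Reasoning
    open +-*-Solver
    τ′ = τ ∘ Fin.lift 1 (headTo j)
    s₀ = -1ℤ ℤ.^ count (λ i → τ (suc i) <ᵇ τ zero)
    rearrange : ∀ a b c → - (a ℤ.* (b ℤ.* c)) ≡ (-1ℤ ℤ.* b) ℤ.* (a ℤ.* c)
    rearrange = solve 3 (λ a b c → :- (a :* (b :* c)) := (con -1ℤ :* b) :* (a :* c)) refl

sign-∘-decode : ∀ {n k} (τ : Fin n → Fin k) → Injective _≡_ _≡_ τ →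
                ∀ c → sign (τ ∘ decode c) ≡ sign τ ℤ.* codeSign c
sign-∘-decode {zero}  τ τ-inj c       = refl
sign-∘-decode {suc n} τ τ-inj (j , c) = begin
  sign (τ ∘ decode (j , c))                       ≡⟨ sign-cong {π = τ ∘ decode (j , c)} {π′ = τ′ ∘ Fin.lift 1 (decode c)} (λ { zero → refl ; (suc i) → cong (τ ∘ punchIn j) (sym (decode-idCode (decode c i))) }) ⟩
  sign (τ′ ∘ Fin.lift 1 (decode c))               ≡⟨ sign-∘-lift-decode τ′ c ⟩
  s₀ ℤ.* sign (τ′ ∘ suc ∘ decode c)               ≡⟨ cong (s₀ ℤ.*_) (sign-∘-decode (τ′ ∘ suc) (suc-injective ∘ τ′-inj) c) ⟩
  s₀ ℤ.* (sign (τ′ ∘ suc) ℤ.* codeSign c)         ≡⟨ ℤₚ.*-assoc s₀ _ _ ⟨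
  s₀ ℤ.* sign (τ′ ∘ suc) ℤ.* codeSign c           ≡⟨ cong (ℤ._* codeSign c) (sign-suc τ′) ⟨
  sign τ′ ℤ.* codeSign c                          ≡⟨ cong (ℤ._* codeSign c) (sign-∘-headTo τ τ-inj j) ⟩
  -1ℤ ℤ.^ toℕ j ℤ.* sign τ ℤ.* codeSign c         ≡⟨ ℤ*.xy∙z≈y∙xz (-1ℤ ℤ.^ toℕ j) (sign τ) (codeSign c) ⟩
  sign τ ℤ.* codeSign (j , c)                     ∎
  where
    open ≡-Reasoning
    τ′ = τ ∘ headTo j
    τ′-inj : Injective _≡_ _≡_ τ′
    τ′-inj = decode-injective (j , idCode) ∘ τ-inj
    s₀ = -1ℤ ℤ.^ count (λ i → τ′ (suc i) <ᵇ τ′ zero)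

sign-decode : ∀ {n} (c : Code n) → sign (decode c) ≡ codeSign c
sign-decode {n} c = begin
  sign (decode c)                  ≡⟨ sign-∘-decode id id c ⟩
  sign (id {A = Fin n}) ℤ.* codeSign c ≡⟨ cong (λ m → -1ℤ ℤ.^ m ℤ.* codeSign c) (inversions-id {n}) ⟩
  1ℤ ℤ.* codeSign c        ≡⟨ ℤₚ.*-identityˡ _ ⟩
  codeSign c               ∎
  where open ≡-Reasoning

sign-∘ : ∀ {n} (τ π : Fin n → Fin n) → Injective _≡_ _≡_ τ → Injective _≡_ _≡_ π →
         sign (τ ∘ π) ≡ sign τ ℤ.* sign π
sign-∘ τ π τ-inj π-inj = begin
  sign (τ ∘ π)            ≡⟨ sign-cong {π = τ ∘ π} {π′ = τ ∘ decode c} (cong τ ∘ sym ∘ decode≗π) ⟩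
  sign (τ ∘ decode c)     ≡⟨ sign-∘-decode τ τ-inj c ⟩
  sign τ ℤ.* codeSign c   ≡⟨ cong (sign τ ℤ.*_) (trans (sym (sign-decode c)) (sign-cong decode≗π)) ⟩
  sign τ ℤ.* sign π       ∎
  where
    open ≡-Reasoning
    c = proj₁ (encode π π-inj)
    decode≗π = proj₂ (encode π π-inj)

transposition-matchˡ : ∀ {n} (a b : Fin n) → transposition a b a ≡ b
transposition-matchˡ a b rewrite dec-true (a ≟ a) refl = refl

transposition-matchʳ : ∀ {n} (a b : Fin n) → transposition a b b ≡ a
transposition-matchʳ a b with b ≟ a
... | yes b≡a = b≡a
... | no  _   rewrite dec-true (b ≟ b) refl = refl

transposition-other : ∀ {n} {a b x : Fin n} → x ≢ a → x ≢ b → transposition a b x ≡ x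
transposition-other {a = a} {b} {x} x≢a x≢b rewrite dec-false (x ≟ a) x≢a | dec-false (x ≟ b) x≢b = refl

transposition-injective : ∀ {n} (a b : Fin n) → Injective _≡_ _≡_ (transposition a b)
transposition-injective a b {x} {y} eq =
  trans (sym (transpose-inverse b a)) (trans (cong (transposition b a) eq) (transpose-inverse b a))

-- Conjugate the swap of 0 and 1 by a permutation sending 0, 1 to a, b.
sign-transposition : ∀ {n} {a b : Fin n} → a ≢ b → sign (transposition a b) ≡ -1ℤ
sign-transposition {zero}  {()}
sign-transposition {suc zero} {zero} {zero} a≢b = ⊥-elim (a≢b refl)
sign-transposition {suc (suc n)} {a} {b} a≢b = begin
  s                       ≡⟨ ℤₚ.*-identityʳ s ⟨
  s ℤ.* 1ℤ                ≡⟨ cong (s ℤ.*_) (-1^-square (inversions σ)) ⟨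
  s ℤ.* (sign σ ℤ.* sign σ) ≡⟨ ℤₚ.*-assoc s _ _ ⟨
  s ℤ.* sign σ ℤ.* sign σ ≡⟨ cong (ℤ._* sign σ) conjugate ⟩
  - sign σ ℤ.* sign σ     ≡⟨ ℤₚ.neg-distribˡ-* (sign σ) (sign σ) ⟨
  - (sign σ ℤ.* sign σ)   ≡⟨ cong -_ (-1^-square (inversions σ)) ⟩
  -1ℤ                     ∎
  where
    open ≡-Reasoning
    s = sign (transposition a b)
    σ = decode (a , punchOut a≢b , idCode)
    σ-inj : Injective _≡_ _≡_ σ
    σ-inj = decode-injective (a , punchOut a≢b , idCode)
    σ1≡b : σ (suc zero) ≡ b
    σ1≡b = punchIn-punchOut a≢b
    intertwines : ∀ i → transposition a b (σ i) ≡ σ (swap01 i)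
    intertwines zero          = trans (transposition-matchˡ a b) (sym σ1≡b)
    intertwines (suc zero)    = trans (cong (transposition a b) σ1≡b) (transposition-matchʳ a b)
    intertwines (suc (suc i)) = transposition-other (λ eq → 0≢1+n (sym (σ-inj {suc (suc i)} {zero} eq)))
                                                (λ eq → 2+i≢1 (σ-inj {suc (suc i)} {suc zero} (trans eq (sym σ1≡b))))
      where
        2+i≢1 : suc (suc i) ≢ suc zero
        2+i≢1 ()
    conjugate : s ℤ.* sign σ ≡ - sign σ
    conjugate = begin
      s ℤ.* sign σ                ≡⟨ sign-∘ (transposition a b) σ (transposition-injective a b) σ-inj ⟨
      sign (transposition a b ∘ σ)    ≡⟨ sign-cong intertwines ⟩
      sign (σ ∘ swap01)           ≡⟨ sign-∘-swap01 σ (λ eq → a≢b (trans eq σ1≡b)) ⟩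
      - sign σ                    ∎

infix 4 _∈?_
_∈?_ : ∀ {n} (x : Fin n) xs → Dec (x ∈ xs)
x ∈? xs = any? (x ≟_) xs

count-∈ : ∀ {n} {xs : List (Fin n)} → Unique xs → count (λ x → does (x ∈? xs)) ≡ length xs
count-∈ {n} {[]}     []             = count-false {n} (λ x → does (x ∈? [])) λ _ → refl
count-∈ {n} {y ∷ ys} (y∉ys ∷ ys-u) =
  trans (count-+ _ (λ x → does (x ≟ y)) (λ x → does (x ∈? ys)) split) (cong₂ ℕ._+_ (count-≟ y) (count-∈ ys-u))
  where
    split : ∀ x → bit (does (x ∈? y ∷ ys)) ≡ bit (does (x ≟ y)) ℕ.+ bit (does (x ∈? ys))
    split x with x ≟ y
    ... | yes refl rewrite dec-false (x ∈? ys) (All¬⇒¬Any y∉ys) = refl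
    ... | no  _    = refl
    count-≟ : ∀ {n} (y : Fin n) → count (λ x → does (x ≟ y)) ≡ 1
    count-≟ {suc n} zero    = cong suc (count-false (λ (x : Fin n) → does (Fin.suc x ≟ zero)) λ _ → refl)
    count-≟ {suc n} (suc y) = count-≟ y

length≤ : ∀ {n} {xs : List (Fin n)} → Unique xs → length xs ≤ n
length≤ {xs = xs} xs-u = subst (_≤ _) (count-∈ xs-u) (count≤ (λ x → does (x ∈? xs)))

headOr : ∀ {n} → Fin n → List (Fin n) → Fin n
headOr h []      = h
headOr h (y ∷ _) = y

nextIn : ∀ {n} → Fin n → List (Fin n) → Fin n → Fin n
nextIn h []       x = x
nextIn h (y ∷ ys) x = if does (x ≟ y) then headOr h ys else nextIn h ys x

nextIn-head : ∀ {n} (h y : Fin n) ys → nextIn h (y ∷ ys) y ≡ headOr h ys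
nextIn-head h y ys rewrite dec-true (y ≟ y) refl = refl

nextIn-skip : ∀ {n} {h x y : Fin n} ys → x ≢ y → nextIn h (y ∷ ys) x ≡ nextIn h ys x
nextIn-skip {x = x} {y} ys x≢y rewrite dec-false (x ≟ y) x≢y = refl

nextIn-∉ : ∀ {n} (h : Fin n) xs {x} → x ∉ xs → nextIn h xs x ≡ x
nextIn-∉ h []       x∉ = refl
nextIn-∉ h (y ∷ ys) x∉ = trans (nextIn-skip ys (x∉ ∘ here)) (nextIn-∉ h ys (x∉ ∘ there))

Chain : ∀ {n} → (Fin n → Fin n → Set) → Fin n → List (Fin n) → Set
Chain R h []       = ⊤
Chain R h (y ∷ ys) = R y (headOr h ys) × Chain R h ys

nextIn-chain : ∀ {n} {R : Fin n → Fin n → Set} {h : Fin n} xs → Chain R h xs →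
               ∀ {x} → x ∈ xs → R x (nextIn h xs x)
nextIn-chain (y ∷ ys) (Ryh , chain) {x} x∈ with x ≟ y | x∈
... | yes refl | _        = Ryh
... | no  x≢y  | here x≡y = ⊥-elim (x≢y x≡y)
... | no  _    | there x∈ys = nextIn-chain ys chain x∈ys

cycle : ∀ {n} → List (Fin n) → Fin n → Fin n
cycle []      = id
cycle (a ∷ r) = nextIn a (a ∷ r)

cycle-∉ : ∀ {n} (xs : List (Fin n)) {x} → x ∉ xs → cycle xs x ≡ x
cycle-∉ []      x∉ = refl
cycle-∉ (a ∷ r) x∉ = nextIn-∉ a (a ∷ r) x∉

cycle-singleton : ∀ {n} (a x : Fin n) → cycle (a ∷ []) x ≡ x
cycle-singleton a x with x ≟ a
... | yes x≡a = sym x≡a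
... | no  _   = refl

cycle-step : ∀ {n} {a₀ a₁ : Fin n} {rest} → Unique (a₀ ∷ a₁ ∷ rest) →
             ∀ x → cycle (a₀ ∷ a₁ ∷ rest) x ≡ cycle (a₀ ∷ rest) (transposition a₀ a₁ x)
cycle-step {a₀ = a₀} {a₁} {rest} ((a₀≢a₁ ∷ _) ∷ (a₁∉rest ∷ _)) x = by-cases (x ≟ a₀) (x ≟ a₁)
  where
    open ≡-Reasoning
    by-cases : Dec (x ≡ a₀) → Dec (x ≡ a₁) → cycle (a₀ ∷ a₁ ∷ rest) x ≡ cycle (a₀ ∷ rest) (transposition a₀ a₁ x)
    by-cases (yes refl) _ = begin
      nextIn x (x ∷ a₁ ∷ rest) x               ≡⟨ nextIn-head x x (a₁ ∷ rest) ⟩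
      a₁                                       ≡⟨ nextIn-∉ x (x ∷ rest) (All¬⇒¬Any ((a₀≢a₁ ∘ sym) ∷ a₁∉rest)) ⟨
      cycle (x ∷ rest) a₁                      ≡⟨ cong (cycle (x ∷ rest)) (transposition-matchˡ x a₁) ⟨
      cycle (x ∷ rest) (transposition x a₁ x)  ∎
    by-cases (no x≢a₀) (yes refl) = begin
      nextIn a₀ (a₀ ∷ x ∷ rest) x              ≡⟨ nextIn-skip (x ∷ rest) x≢a₀ ⟩
      nextIn a₀ (x ∷ rest) x                   ≡⟨ nextIn-head a₀ x rest ⟩
      headOr a₀ rest                           ≡⟨ nextIn-head a₀ a₀ rest ⟨
      cycle (a₀ ∷ rest) a₀                     ≡⟨ cong (cycle (a₀ ∷ rest)) (transposition-matchʳ a₀ x) ⟨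
      cycle (a₀ ∷ rest) (transposition a₀ x x) ∎
    by-cases (no x≢a₀) (no x≢a₁) = begin
      nextIn a₀ (a₀ ∷ a₁ ∷ rest) x               ≡⟨ nextIn-skip (a₁ ∷ rest) x≢a₀ ⟩
      nextIn a₀ (a₁ ∷ rest) x                    ≡⟨ nextIn-skip rest x≢a₁ ⟩
      nextIn a₀ rest x                           ≡⟨ nextIn-skip rest x≢a₀ ⟨
      cycle (a₀ ∷ rest) x                        ≡⟨ cong (cycle (a₀ ∷ rest)) (transposition-other x≢a₀ x≢a₁) ⟨
      cycle (a₀ ∷ rest) (transposition a₀ a₁ x)  ∎

Unique-drop₂ : ∀ {n} {a₀ a₁ : Fin n} {rest} → Unique (a₀ ∷ a₁ ∷ rest) → Unique (a₀ ∷ rest)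
Unique-drop₂ ((_ ∷ a₀∉rest) ∷ (_ ∷ rest-u)) = a₀∉rest ∷ rest-u

cycle-injective : ∀ {n} {a : Fin n} {r} → Unique (a ∷ r) → Injective _≡_ _≡_ (cycle (a ∷ r))
cycle-injective {a = a} {[]} _ {x} {y} eq = trans (sym (cycle-singleton a x)) (trans eq (cycle-singleton a y))
cycle-injective {a = a} {a₁ ∷ rest} u {x} {y} eq =
  transposition-injective a a₁ (cycle-injective (Unique-drop₂ u)
    (trans (sym (cycle-step u x)) (trans eq (cycle-step u y))))

sign-cycle : ∀ {n} {a : Fin n} {r} → Unique (a ∷ r) → sign (cycle (a ∷ r)) ≡ -1ℤ ℤ.^ length r
sign-cycle {n} {a} {[]}        _ = trans (sign-cong {π′ = id} (cycle-singleton a)) (cong (-1ℤ ℤ.^_) (inversions-id {n}))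
sign-cycle {n} {a} {a₁ ∷ rest} u@((a≢a₁ ∷ _) ∷ _) = begin
  sign (cycle (a ∷ a₁ ∷ rest))                          ≡⟨ sign-cong (cycle-step u) ⟩
  sign (cycle (a ∷ rest) ∘ transposition a a₁)          ≡⟨ sign-∘ _ _ (cycle-injective (Unique-drop₂ u)) (transposition-injective a a₁) ⟩
  sign (cycle (a ∷ rest)) ℤ.* sign (transposition a a₁) ≡⟨ cong₂ ℤ._*_ (sign-cycle (Unique-drop₂ u)) (sign-transposition a≢a₁) ⟩
  -1ℤ ℤ.^ length rest ℤ.* -1ℤ                           ≡⟨ ℤₚ.*-comm _ -1ℤ ⟩
  -1ℤ ℤ.^ length (a₁ ∷ rest)                            ∎
  where open ≡-Reasoning

-- The Leibniz expansion of det (xI - A)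

δ : ℕ → ℕ → ℤ
δ k m = if does (k ℕ.≟ m) then 1ℤ else 0ℤ

δ-refl : ∀ k → δ k k ≡ 1ℤ
δ-refl k rewrite dec-true (k ℕ.≟ k) refl = refl

δ-≢ : ∀ {k m} → k ≢ m → δ k m ≡ 0ℤ
δ-≢ {k} {m} k≢m rewrite dec-false (k ℕ.≟ m) k≢m = refl

coeff-0∷[] : ∀ k → coeff (0ℤ ∷ []) k ≡ 0ℤ
coeff-0∷[] zero    = refl
coeff-0∷[] (suc k) = refl

coeff-x*P-zero : ∀ q → coeff ((X +P negP (constP 0ℤ)) *P q) zero ≡ 0ℤ
coeff-x*P-zero q = trans (coeff-+P (scal 0ℤ q) _ zero) (trans (ℤₚ.+-identityʳ _) (trans (coeff-scal 0ℤ q zero) (ℤₚ.*-zeroˡ (coeff q zero))))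

coeff-x*P-suc : ∀ q k → coeff ((X +P negP (constP 0ℤ)) *P q) (suc k) ≡ coeff q k
coeff-x*P-suc q k = begin
  coeff (scal 0ℤ q +P (0ℤ ∷ (scal 1ℤ q +P (0ℤ ∷ [])))) (suc k)             ≡⟨ coeff-+P (scal 0ℤ q) _ (suc k) ⟩
  coeff (scal 0ℤ q) (suc k) ℤ.+ coeff (scal 1ℤ q +P (0ℤ ∷ [])) k           ≡⟨ cong₂ ℤ._+_ (coeff-scal 0ℤ q (suc k)) (coeff-+P (scal 1ℤ q) _ k) ⟩
  0ℤ ℤ.* coeff q (suc k) ℤ.+ (coeff (scal 1ℤ q) k ℤ.+ coeff (0ℤ ∷ []) k)   ≡⟨ cong₂ (λ a b → a ℤ.+ (b ℤ.+ coeff (0ℤ ∷ []) k)) (ℤₚ.*-zeroˡ (coeff q (suc k))) (coeff-scal 1ℤ q k) ⟩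
  0ℤ ℤ.+ (1ℤ ℤ.* coeff q k ℤ.+ coeff (0ℤ ∷ []) k)                          ≡⟨ ℤₚ.+-identityˡ (1ℤ ℤ.* coeff q k ℤ.+ coeff (0ℤ ∷ []) k) ⟩
  1ℤ ℤ.* coeff q k ℤ.+ coeff (0ℤ ∷ []) k                                   ≡⟨ cong₂ ℤ._+_ (ℤₚ.*-identityˡ (coeff q k)) (coeff-0∷[] k) ⟩
  coeff q k ℤ.+ 0ℤ                                                          ≡⟨ ℤₚ.+-identityʳ (coeff q k) ⟩
  coeff q k                                                                 ∎
  where open ≡-Reasoning

coeff-negConst*P : ∀ a q k → coeff (([] +P negP (constP a)) *P q) k ≡ - a ℤ.* coeff q k
coeff-negConst*P a q k = begin
  coeff (scal (-1ℤ ℤ.* a) q +P (0ℤ ∷ [])) k   ≡⟨ coeff-+P (scal (-1ℤ ℤ.* a) q) _ k ⟩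
  coeff (scal (-1ℤ ℤ.* a) q) k ℤ.+ coeff (0ℤ ∷ []) k ≡⟨ cong₂ ℤ._+_ (coeff-scal (-1ℤ ℤ.* a) q k) (coeff-0∷[] k) ⟩
  -1ℤ ℤ.* a ℤ.* coeff q k ℤ.+ 0ℤ              ≡⟨ ℤₚ.+-identityʳ _ ⟩
  -1ℤ ℤ.* a ℤ.* coeff q k                     ≡⟨ cong (ℤ._* coeff q k) (ℤₚ.-1*i≡-i a) ⟩
  - a ℤ.* coeff q k                           ∎
  where open ≡-Reasoning

-- ρ and κ pick the rows and columns of a minor of xI - A. In the expansion a fixed point of the
-- permutation contributes x, any other point i contributes -A i (π i).
module Leibniz {K : ℕ} (A : Mat K) (zero-diagonal : ∀ u → A u u ≡ 0ℤ) where

  entry : Fin K → Fin K → Poly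
  entry = charPolyMatrix A

  weight : Fin K → Fin K → ℤ
  weight u v = if does (u ≟ v) then 1ℤ else - A u v

  fixedCount : ∀ {N} (ρ κ : Fin N → Fin K) → Code N → ℕ
  fixedCount ρ κ c = count λ i → does (ρ i ≟ κ (decode c i))

  term : ∀ {N} (ρ κ : Fin N → Fin K) → ℕ → Code N → ℤ
  term ρ κ k c = codeSign c ℤ.* (prodℤ (λ i → weight (ρ i) (κ (decode c i))) ℤ.* δ k (fixedCount ρ κ c))

  private
    open +-*-Solver

    diagonal-rearrange : ∀ s c p d → s ℤ.* (c ℤ.* (p ℤ.* d)) ≡ (s ℤ.* c) ℤ.* ((1ℤ ℤ.* p) ℤ.* d)
    diagonal-rearrange = solve 4 (λ s c p d → s :* (c :* (p :* d)) := (s :* c) :* ((con 1ℤ :* p) :* d)) refl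

    offdiagonal-rearrange : ∀ s w c p d → s ℤ.* (w ℤ.* (c ℤ.* (p ℤ.* d))) ≡ (s ℤ.* c) ℤ.* ((w ℤ.* p) ℤ.* d)
    offdiagonal-rearrange = solve 5 (λ s w c p d → s :* (w :* (c :* (p :* d))) := (s :* c) :* ((w :* p) :* d)) refl

  laplace-term : ∀ {N} (ρ κ : Fin (suc N) → Fin K) j q →
                 (∀ k → coeff q k ≡ sumCode (term (ρ ∘ suc) (κ ∘ punchIn j) k)) →
                 ∀ k → -1ℤ ℤ.^ toℕ j ℤ.* coeff (entry (ρ zero) (κ j) *P q) k ≡ sumCode (λ c → term ρ κ k (j , c))
  laplace-term ρ κ j q q-coeff k with ρ zero ≟ κ j
  ... | yes ρ0≡κj rewrite trans (cong (A (ρ zero)) (sym ρ0≡κj)) (zero-diagonal (ρ zero)) with k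
  ...   | zero = begin
    s ℤ.* coeff ((X +P negP (constP 0ℤ)) *P q) zero ≡⟨ cong (s ℤ.*_) (coeff-x*P-zero q) ⟩
    s ℤ.* 0ℤ                                         ≡⟨ ℤₚ.*-zeroʳ s ⟩
    0ℤ                                               ≡⟨ sumCode-zero _ (λ c → trans (cong (s ℤ.* codeSign c ℤ.*_) (ℤₚ.*-zeroʳ (1ℤ ℤ.* p c))) (ℤₚ.*-zeroʳ (s ℤ.* codeSign c))) ⟨
    _                                                ∎
    where
      open ≡-Reasoning
      s = -1ℤ ℤ.^ toℕ j
      p : Code _ → ℤ
      p c = prodℤ λ i → weight (ρ (suc i)) (κ (punchIn j (decode c i)))
  ...   | suc k = begin
    s ℤ.* coeff ((X +P negP (constP 0ℤ)) *P q) (suc k) ≡⟨ cong (s ℤ.*_) (trans (coeff-x*P-suc q k) (q-coeff k)) ⟩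
    s ℤ.* sumCode t                                     ≡⟨ *-distribˡ-sumCode s t ⟩
    sumCode (λ c → s ℤ.* t c)                           ≡⟨ sumCode-cong (λ c → diagonal-rearrange s (codeSign c) (p c) (δ k (fixedCount (ρ ∘ suc) (κ ∘ punchIn j) c))) ⟩
    _                                                   ∎
    where
      open ≡-Reasoning
      s = -1ℤ ℤ.^ toℕ j
      t = term (ρ ∘ suc) (κ ∘ punchIn j) k
      p : Code _ → ℤ
      p c = prodℤ λ i → weight (ρ (suc i)) (κ (punchIn j (decode c i)))
  laplace-term ρ κ j q q-coeff k | no _ = begin
    s ℤ.* coeff (([] +P negP (constP a)) *P q) k ≡⟨ cong (s ℤ.*_) (trans (coeff-negConst*P a q k) (cong (- a ℤ.*_) (q-coeff k))) ⟩
    s ℤ.* (- a ℤ.* sumCode t)                    ≡⟨ cong (s ℤ.*_) (*-distribˡ-sumCode (- a) t) ⟩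
    s ℤ.* sumCode (λ c → - a ℤ.* t c)            ≡⟨ *-distribˡ-sumCode s (λ c → - a ℤ.* t c) ⟩
    sumCode (λ c → s ℤ.* (- a ℤ.* t c))          ≡⟨ sumCode-cong (λ c → offdiagonal-rearrange s (- a) (codeSign c) (p c) (δ k (fixedCount (ρ ∘ suc) (κ ∘ punchIn j) c))) ⟩
    _                                            ∎
    where
      open ≡-Reasoning
      s = -1ℤ ℤ.^ toℕ j
      a = A (ρ zero) (κ j)
      t = term (ρ ∘ suc) (κ ∘ punchIn j) k
      p : Code _ → ℤ
      p c = prodℤ λ i → weight (ρ (suc i)) (κ (punchIn j (decode c i)))

  coeff-det : ∀ N (ρ κ : Fin N → Fin K) k →
              coeff (det N (λ i j → entry (ρ i) (κ j))) k ≡ sumCode (term ρ κ k)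
  coeff-det zero    ρ κ zero    = refl
  coeff-det zero    ρ κ (suc k) = refl
  coeff-det (suc N) ρ κ k = begin
    coeff (sumP λ j → signP (toℕ j) (entry (ρ zero) (κ j) *P minor j)) k      ≡⟨ coeff-sumP (λ j → signP (toℕ j) (entry (ρ zero) (κ j) *P minor j)) k ⟩
    sumℤ (λ j → coeff (signP (toℕ j) (entry (ρ zero) (κ j) *P minor j)) k)  ≡⟨ sumℤ-cong (λ j → coeff-signP (toℕ j) (entry (ρ zero) (κ j) *P minor j) k) ⟩
    sumℤ (λ j → -1ℤ ℤ.^ toℕ j ℤ.* coeff (entry (ρ zero) (κ j) *P minor j) k) ≡⟨ sumℤ-cong (λ j → laplace-term ρ κ j (minor j) (coeff-det N (ρ ∘ suc) (κ ∘ punchIn j)) k) ⟩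
    sumCode (term ρ κ k)                                                      ∎
    where
      open ≡-Reasoning
      minor : Fin (suc N) → Poly
      minor j = det N (λ i l → entry (ρ (suc i)) (κ (punchIn j l)))

  coeff-charPoly : ∀ k → coeff (charPoly A) k ≡ sumCode (term id id k)
  coeff-charPoly k = trans (cong (λ p → coeff p k) (charPoly≡det A)) (coeff-det K id id k)

isFixed : ∀ {n} → (Fin n → Fin n) → Fin n → Bool
isFixed π i = does (i ≟ π i)

support : ∀ {n} → (Fin n → Fin n) → ℕ
support π = count (not ∘ isFixed π)

isFixed-true : ∀ {n} {π : Fin n → Fin n} {i} → π i ≡ i → isFixed π i ≡ true
isFixed-true {π = π} {i} πi≡i = dec-true (i ≟ π i) (sym πi≡i)

isFixed-false : ∀ {n} {π : Fin n → Fin n} {i} → π i ≢ i → isFixed π i ≡ false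
isFixed-false {π = π} {i} πi≢i = dec-false (i ≟ π i) (πi≢i ∘ sym)

isFixed-false⁻ : ∀ {n} {π : Fin n → Fin n} {i} → isFixed π i ≡ false → π i ≢ i
isFixed-false⁻ {π = π} fixed≡false πi≡i with () ← trans (sym (isFixed-true {π = π} πi≡i)) fixed≡false

support-cong : ∀ {n} {π π′ : Fin n → Fin n} → (∀ i → π i ≡ π′ i) → support π ≡ support π′
support-cong π≗π′ = count-cong λ i → cong (λ j → not (does (i ≟ j))) (π≗π′ i)

support≡0 : ∀ {n} (π : Fin n → Fin n) → support π ≡ 0 → ∀ i → π i ≡ i
support≡0 π none i with i ≟ π i | count≡0⇒false (not ∘ isFixed π) none i
... | yes i≡πi | _ = sym i≡πi

support-moved : ∀ {n} (π : Fin n → Fin n) → support π ≢ 0 → ∃[ i ] π i ≢ i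
support-moved π support≢0 with count≢0⇒true (not ∘ isFixed π) support≢0
... | i , moved = i , isFixed-false⁻ {π = π} (trans (sym (not-involutive _)) (cong not moved))

support-≡-length : ∀ {n} (π : Fin n → Fin n) {xs} → Unique xs →
                   (∀ {x} → x ∈ xs → π x ≢ x) → (∀ {x} → x ∉ xs → π x ≡ x) → support π ≡ length xs
support-≡-length π {xs} xs-u moves fixes = trans (count-cong moved≡∈) (count-∈ xs-u)
  where
    moved≡∈ : ∀ x → not (isFixed π x) ≡ does (x ∈? xs)
    moved≡∈ x with x ∈? xs
    ... | yes x∈ = cong not (isFixed-false {π = π} (moves x∈))
    ... | no  x∉ = cong not (isFixed-true {π = π} (fixes x∉))

chain-applyUpTo : ∀ {n} {R : Fin n → Fin n → Set} {h} (f : ℕ → Fin n) m →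
                  (∀ i → i < m → R (f i) (f (suc i))) → R (f m) h → Chain R h (applyUpTo f (suc m))
chain-applyUpTo f zero    steps last = last , tt
chain-applyUpTo f (suc m) steps last =
  steps 0 (s≤s z≤n) , chain-applyUpTo (f ∘ suc) m (λ i i<m → steps (suc i) (s≤s i<m)) last

module Orbit {n} (σ : Fin n → Fin n) (σ-inj : Injective _≡_ _≡_ σ) (a : Fin n) (σa≢a : σ a ≢ a) where

  orbit : ℕ → Fin n
  orbit zero    = a
  orbit (suc k) = σ (orbit k)

  orbit-cancel : ∀ i m → orbit i ≡ orbit (i ℕ.+ m) → a ≡ orbit m
  orbit-cancel zero    m eq = eq
  orbit-cancel (suc i) m eq = orbit-cancel i m (σ-inj eq)

  orbit-repeats⇒returns : ∀ {i j} → i < j → orbit i ≡ orbit j → ∃[ d ] (i ℕ.+ suc d ≡ j × orbit (suc d) ≡ a)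
  orbit-repeats⇒returns {i} {j} i<j eq = d , j≡ , sym (orbit-cancel i (suc d) (trans eq (cong orbit (sym j≡))))
    where
      d = proj₁ (ℕₚ.m≤n⇒∃[o]m+o≡n i<j)
      j≡ : i ℕ.+ suc d ≡ j
      j≡ = trans (ℕₚ.+-suc i d) (proj₂ (ℕₚ.m≤n⇒∃[o]m+o≡n i<j))

  -- Abstract, since normalising the pigeonhole witnesses is prohibitively slow.
  private abstract
    returns : ∃[ d ] (d < n × orbit (suc d) ≡ a)
    returns with pigeonhole (ℕₚ.n<1+n n) (orbit ∘ toℕ)
    ... | i , j , i<j , eq with orbit-repeats⇒returns i<j eq
    ...   | d , j≡ , ret = d , ℕₚ.<-≤-trans (s≤s (ℕₚ.m≤n+m d (toℕ i))) (subst (_≤ n) j≡′ (ℕ.s≤s⁻¹ (toℕ<n j))) , ret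
      where
        j≡′ : toℕ j ≡ suc (toℕ i ℕ.+ d)
        j≡′ = trans (sym j≡) (ℕₚ.+-suc (toℕ i) d)

    returnsFirst : ∃[ p ] (orbit (suc p) ≡ a × ∀ k → k < p → orbit (suc k) ≢ a)
    returnsFirst with ¬∀⟶∃¬-smallest n (λ i → orbit (suc (toℕ i)) ≢ a) (λ i → ¬? (orbit (suc (toℕ i)) ≟ a)) never-returns
      where
        never-returns : ¬ (∀ (i : Fin n) → orbit (suc (toℕ i)) ≢ a)
        never-returns all with d , d<n , ret ← returns =
          all (Fin.fromℕ< d<n) (subst (λ m → orbit (suc m) ≡ a) (sym (toℕ-fromℕ< d<n)) ret)
    ... | i , ¬¬ret , earlier = toℕ i , decidable-stable (orbit (suc (toℕ i)) ≟ a) ¬¬ret , never-earlier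
      where
        never-earlier : ∀ k → k < toℕ i → orbit (suc k) ≢ a
        never-earlier k k<i = subst (λ m → orbit (suc m) ≢ a)
          (trans (toℕ-inject (Fin.fromℕ< k<i)) (toℕ-fromℕ< k<i)) (earlier (Fin.fromℕ< k<i))

  period : ℕ
  period = suc (proj₁ returnsFirst)

  orbit-period : orbit period ≡ a
  orbit-period = proj₁ (proj₂ returnsFirst)

  orbit-injective : ∀ {i j} → i < j → j < period → orbit i ≢ orbit j
  orbit-injective {i} {j} i<j j<period eq with orbit-repeats⇒returns i<j eq
  ... | d , j≡ , ret = proj₂ (proj₂ returnsFirst) d d<p ret
    where
      d<p : d < proj₁ returnsFirst
      d<p = ℕₚ.≤-trans (ℕₚ.m≤n+m (suc d) i) (ℕ.s≤s⁻¹ (subst (_< period) (sym j≡) j<period))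

  L : List (Fin n)
  L = applyUpTo orbit period

  L-unique : Unique L
  L-unique = applyUpTo⁺₁ orbit period orbit-injective

  L-chain : Chain (λ x y → y ≡ σ x) a L
  L-chain = chain-applyUpTo orbit (proj₁ returnsFirst) (λ _ _ → refl) (sym orbit-period)

  σ-moves-L : ∀ {x} → x ∈ L → σ x ≢ x
  σ-moves-L x∈ with ∈-applyUpTo⁻ orbit x∈
  ... | i , _ , refl = λ eq → σa≢a (sym (orbit-cancel i 1 (trans (sym eq) (cong orbit (ℕₚ.+-comm 1 i)))))

  σ-reflects-L : ∀ {x} → σ x ∈ L → x ∈ L
  σ-reflects-L {x} σx∈ with ∈-applyUpTo⁻ orbit σx∈
  ... | zero  , _       , σx≡a  = subst (_∈ L) (sym (σ-inj (trans σx≡a (sym orbit-period)))) (∈-applyUpTo⁺ orbit (ℕₚ.n<1+n _))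
  ... | suc i , 1+i<per , σx≡σi = subst (_∈ L) (sym (σ-inj σx≡σi)) (∈-applyUpTo⁺ orbit (ℕₚ.<-trans (ℕₚ.n<1+n i) 1+i<per))

  orbitCycle : Fin n → Fin n
  orbitCycle = cycle L

  orbitCycle-∈ : ∀ {x} → x ∈ L → orbitCycle x ≡ σ x
  orbitCycle-∈ = nextIn-chain L L-chain

  support-orbitCycle : support orbitCycle ≡ period
  support-orbitCycle = trans
    (support-≡-length orbitCycle L-unique (λ x∈ eq → σ-moves-L x∈ (trans (sym (orbitCycle-∈ x∈)) eq)) (cycle-∉ L))
    (length-applyUpTo orbit period)

  rest : Fin n → Fin n
  rest x = if does (x ∈? L) then x else σ x

  rest-∉ : ∀ {x} → x ∉ L → rest x ≡ σ x
  rest-∉ {x} x∉ rewrite dec-false (x ∈? L) x∉ = refl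

  rest-∈ : ∀ {x} → x ∈ L → rest x ≡ x
  rest-∈ {x} x∈ rewrite dec-true (x ∈? L) x∈ = refl

  rest-injective : Injective _≡_ _≡_ rest
  rest-injective {x} {y} eq with x ∈? L | y ∈? L
  ... | yes x∈ | yes y∈ = trans (sym (rest-∈ x∈)) (trans eq (rest-∈ y∈))
  ... | no  x∉ | no  y∉ = σ-inj (trans (sym (rest-∉ x∉)) (trans eq (rest-∉ y∉)))
  ... | yes x∈ | no  y∉ = ⊥-elim (y∉ (σ-reflects-L (subst (_∈ L) (trans (sym (rest-∈ x∈)) (trans eq (rest-∉ y∉))) x∈)))
  ... | no  x∉ | yes y∈ = ⊥-elim (x∉ (σ-reflects-L (subst (_∈ L) (trans (sym (rest-∈ y∈)) (trans (sym eq) (rest-∉ x∉))) y∈)))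

  support-split : support σ ≡ period ℕ.+ support rest
  support-split = trans (count-+ _ _ _ moved-split) (cong (ℕ._+ support rest) support-orbitCycle)
    where
      moved-split : ∀ x → bit (not (isFixed σ x)) ≡ bit (not (isFixed orbitCycle x)) ℕ.+ bit (not (isFixed rest x))
      moved-split x with x ∈? L
      ... | yes x∈ rewrite orbitCycle-∈ x∈ | isFixed-true {π = rest} (rest-∈ x∈) = sym (ℕₚ.+-identityʳ _)
      ... | no  x∉ rewrite isFixed-true {π = orbitCycle} (cycle-∉ L x∉) | rest-∉ x∉ = refl

-- Walks and bipartite graphs

infixr 5 _◅_
data Walk {n} (Γ : Graph n) : Fin n → Fin n → ℕ → Set where
  ε   : ∀ {u} → Walk Γ u u 0
  _◅_ : ∀ {u v w k} → adj Γ u v ≡ true → Walk Γ v w k → Walk Γ u w (suc k)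

module _ {n} {Γ : Graph n} where

  _▻_ : ∀ {u v w k} → Walk Γ u v k → adj Γ v w ≡ true → Walk Γ u w (suc k)
  ε       ▻ e = e ◅ ε
  (d ◅ p) ▻ e = d ◅ (p ▻ e)

  _◅◅_ : ∀ {u v w k l} → Walk Γ u v k → Walk Γ v w l → Walk Γ u w (k ℕ.+ l)
  ε       ◅◅ q = q
  (e ◅ p) ◅◅ q = e ◅ (p ◅◅ q)

  reverse : ∀ {u v k} → Walk Γ u v k → Walk Γ v u k
  reverse ε                   = ε
  reverse (_◅_ {u} {v} e p) = reverse p ▻ trans (adj-sym Γ v u) e

  -- The endpoint is not included.
  vertices : ∀ {u v k} → Walk Γ u v k → List (Fin n)
  vertices ε                 = []
  vertices (_◅_ {u} _ p) = u ∷ vertices p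

  length-vertices : ∀ {u v k} (p : Walk Γ u v k) → length (vertices p) ≡ k
  length-vertices ε       = refl
  length-vertices (_ ◅ p) = cong suc (length-vertices p)

  vertices-chain : ∀ {u v k} (p : Walk Γ u v k) → Chain (λ x y → adj Γ x y ≡ true) v (vertices p)
  vertices-chain ε           = tt
  vertices-chain (e ◅ ε)     = e , tt
  vertices-chain (e ◅ d ◅ p) = e , vertices-chain (d ◅ p)

  walk? : ∀ u v k → Dec (Walk Γ u v k)
  walk? u v zero with u ≟ v
  ... | yes refl = yes ε
  ... | no  u≢v  = no λ { ε → u≢v refl }
  walk? u v (suc k) with Finₚ.any? (λ w → (adj Γ u w Boolₚ.≟ true) ×-dec walk? w v k)
  ... | yes (w , e , p) = yes (e ◅ p)
  ... | no  none        = no λ { (_◅_ {v = w} e p) → none (w , e , p) }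

  splitWalk-∈ : ∀ {u v x k} (p : Walk Γ u v k) → x ∈ vertices p →
              ∃₂ λ k₁ k₂ → Walk Γ u x k₁ × Walk Γ x v (suc k₂) × k₁ ℕ.+ suc k₂ ≡ k
  splitWalk-∈ (e ◅ p) (here refl)  = 0 , _ , ε , e ◅ p , refl
  splitWalk-∈ (e ◅ p) (there x∈p) with splitWalk-∈ p x∈p
  ... | k₁ , k₂ , p₁ , p₂ , splits = suc k₁ , k₂ , e ◅ p₁ , p₂ , cong suc splits

  record Detour (u v : Fin n) (k : ℕ) : Set where
    field
      {x}      : Fin n
      {k₁ k₂}  : ℕ
      shortcut : Walk Γ u v (suc k₁)
      loop     : Walk Γ x x (suc k₂)
      splits   : suc k₁ ℕ.+ suc k₂ ≡ k

  removeLoop : ∀ {u v k} (p : Walk Γ u v k) → Unique (vertices p) ⊎ Detour u v k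
  removeLoop ε = inj₁ []
  removeLoop (_◅_ {u} e p) with u ∈? vertices p
  ... | yes u∈p = let k₁ , k₂ , p₁ , p₂ , splits = splitWalk-∈ p u∈p in
    inj₂ (record { shortcut = p₂ ; loop = e ◅ p₁ ; splits = trans (ℕₚ.+-suc (suc k₂) k₁) (cong suc (trans (ℕₚ.+-comm (suc k₂) k₁) splits)) })
  ... | no  u∉p with removeLoop p
  ...   | inj₁ unique = inj₁ (¬Any⇒All¬ (vertices p) u∉p ∷ unique)
  ...   | inj₂ detour = inj₂ (record { shortcut = e ◅ shortcut ; loop = loop ; splits = cong suc splits })
    where open Detour detour

module _ {n} (Γ : Graph n) where

  NoOddClosedWalk : Set
  NoOddClosedWalk = ∀ {u k} → Walk Γ u u k → parity k ≡ 0ℙ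

  -- The bound on the length makes ShortWalk decidable.
  ShortWalk : Fin n → Fin n → Parity → Set
  ShortWalk u v p = ∃ λ (m : Fin (suc n)) → parity (toℕ m) ≡ p × Walk Γ u v (toℕ m)

  shortWalk? : ∀ u v p → Dec (ShortWalk u v p)
  shortWalk? u v p = Finₚ.any? λ m → (parity (toℕ m) Parityₚ.≟ p) ×-dec walk? u v (toℕ m)

  parity-detour : ∀ {k₁ k₂ k} → suc k₁ ℕ.+ suc k₂ ≡ k → parity k ≡ parity (suc k₁) ℙ.+ parity (suc k₂)
  parity-detour {k₁} {k₂} refl = Parityₚ.+-homo-+ (suc k₁) (suc k₂)

  -- Cutting out (even) closed subwalks.
  shorten : NoOddClosedWalk → ∀ {u v k} → Walk Γ u v k → ShortWalk u v (parity k)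
  shorten noOdd = <-rec (λ k → ∀ {u v} → Walk Γ u v k → ShortWalk u v (parity k)) step _
    where
      step : ∀ k → (∀ {k′} → k′ < k → ∀ {u v} → Walk Γ u v k′ → ShortWalk u v (parity k′)) →
             ∀ {u v} → Walk Γ u v k → ShortWalk u v (parity k)
      step k shorter p with removeLoop p
      ... | inj₁ unique = Fin.fromℕ< k<1+n , cong parity (toℕ-fromℕ< k<1+n) ,
                          subst (Walk Γ _ _) (sym (toℕ-fromℕ< k<1+n)) p
        where
          k<1+n : k < suc n
          k<1+n = s≤s (subst (_≤ n) (length-vertices p) (length≤ unique))
      ... | inj₂ detour with shorter (subst (suc k₁ <_) splits (ℕₚ.m<m+n (suc k₁) (s≤s z≤n))) shortcut
        where open Detour detour
      ...   | m , parity-m , q = m , trans parity-m (sym parity-k) , q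
        where
          open Detour detour
          parity-k : parity k ≡ parity (suc k₁)
          parity-k = trans (parity-detour splits) (trans (cong (parity (suc k₁) ℙ.+_) (noOdd loop)) (Parityₚ.+-identityʳ _))

  Connected : Fin n → Fin n → Set
  Connected u v = ∃ λ (m : Fin (suc n)) → Walk Γ u v (toℕ m)

  connected? : ∀ u v → Dec (Connected u v)
  connected? u v = Finₚ.any? λ m → walk? u v (toℕ m)

  module Colouring (noOdd : NoOddClosedWalk) where

    root : Fin n → Fin n
    root v = proj₁ (least (λ u → connected? u v) (zero , ε))

    root-connected : ∀ v → Connected (root v) v
    root-connected v = proj₁ (proj₂ (least (λ u → connected? u v) (zero , ε)))

    root-least : ∀ {v z} → Connected z v → root v Fin.≤ z
    root-least {v} = proj₂ (proj₂ (least (λ u → connected? u v) (zero , ε)))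

    root-edge : ∀ {u v} → adj Γ u v ≡ true → root v Fin.≤ root u
    root-edge {u} e with root-connected u
    ... | _ , w with shorten noOdd (w ▻ e)
    ...   | m , _ , w′ = root-least (m , w′)

    root-≡ : ∀ {u v} → adj Γ u v ≡ true → root u ≡ root v
    root-≡ {u} {v} e = Finₚ.≤-antisym (root-edge (trans (adj-sym Γ v u) e)) (root-edge e)

    colour : Fin n → Bool
    colour v = does (shortWalk? (root v) v 0ℙ)

    colour-proper : ∀ u v → adj Γ u v ≡ true → colour u ≢ colour v
    colour-proper u v e = by-cases (shortWalk? (root u) u 0ℙ) (shortWalk? (root v) v 0ℙ)
      where
        by-cases : (d₁ : Dec (ShortWalk (root u) u 0ℙ)) (d₂ : Dec (ShortWalk (root v) v 0ℙ)) → does d₁ ≢ does d₂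
        by-cases (yes (a , even-a , wa)) (yes (b , even-b , wb)) _ =
          Parityₚ.p≢p⁻¹ 1ℙ (trans (sym odd) (noOdd (wa ◅◅ (e ◅ reverse (subst (λ r → Walk Γ r v (toℕ b)) (sym (root-≡ e)) wb)))))
          where
            odd : parity (toℕ a ℕ.+ suc (toℕ b)) ≡ 1ℙ
            odd = trans (Parityₚ.+-homo-+ (toℕ a) _) (cong₂ ℙ._+_ even-a (trans (parity-suc (toℕ b)) (cong ℙ._⁻¹ even-b)))
        by-cases (no ¬even-u) (no ¬even-v) _ with root-connected u
        ... | m , w with parity (toℕ m) in parity-m
        ...   | 0ℙ = ¬even-u (m , parity-m , w)
        ...   | 1ℙ with shorten noOdd (w ▻ e)
        ...     | m′ , parity-m′ , w′ = ¬even-v (m′ , trans parity-m′ (trans (parity-suc (toℕ m)) (cong ℙ._⁻¹ parity-m)) ,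
                                                 subst (λ r → Walk Γ r v (toℕ m′)) (root-≡ e) w′)
        by-cases (yes _) (no _) ()
        by-cases (no _) (yes _) ()

  noOddClosedWalk⇒bipartite : NoOddClosedWalk → Bipartite Γ
  noOddClosedWalk⇒bipartite noOdd = colour , colour-proper
    where open Colouring noOdd

  bipartite⇒noOddClosedWalk : Bipartite Γ → NoOddClosedWalk
  bipartite⇒noOddClosedWalk (c , proper) {u} {k} closed with parity k in parity-k
  ... | 0ℙ = refl
  ... | 1ℙ = ⊥-elim (Boolₚ.not-¬ refl (trans (colour-along closed) (cong (λ p → flip p (c u)) parity-k)))
    where
      flip : Parity → Bool → Bool
      flip 0ℙ b = b
      flip 1ℙ b = not b
      flip-not : ∀ p b → flip p (not b) ≡ flip (p ℙ.⁻¹) b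
      flip-not 0ℙ b = refl
      flip-not 1ℙ b = not-involutive b
      colour-along : ∀ {x y m} → Walk Γ x y m → c y ≡ flip (parity m) (c x)
      colour-along ε = refl
      colour-along {x} (_◅_ {v = x′} {k = m} e p) = begin
        c _                                 ≡⟨ colour-along p ⟩
        flip (parity m) (c x′)              ≡⟨ cong (flip (parity m)) (Boolₚ.¬-not (proper x′ x (trans (adj-sym Γ x′ x) e))) ⟩
        flip (parity m) (not (c x))         ≡⟨ flip-not (parity m) (c x) ⟩
        flip (parity m ℙ.⁻¹) (c x)          ≡⟨ cong (λ p → flip p (c x)) (parity-suc m) ⟨
        flip (parity (suc m)) (c x)         ∎
        where open ≡-Reasoning

-- Odd coefficients of the characteristic polynomial

module _ {K} (Γ : Graph K) where

  FollowsEdges : (Fin K → Fin K) → Set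
  FollowsEdges π = ∀ i → π i ≢ i → adj Γ i (π i) ≡ true

  EvenSupports : Set
  EvenSupports = ∀ π → Injective _≡_ _≡_ π → FollowsEdges π → parity (support π) ≡ 0ℙ

  module OrbitAlongEdges (σ : Fin K → Fin K) (σ-inj : Injective _≡_ _≡_ σ) (σ-edges : FollowsEdges σ)
                         (a : Fin K) (σa≢a : σ a ≢ a) where
    open Orbit σ σ-inj a σa≢a public

    orbitCycle-edges : FollowsEdges orbitCycle
    orbitCycle-edges x moved = by-cases (x ∈? L)
      where
        by-cases : Dec (x ∈ L) → adj Γ x (orbitCycle x) ≡ true
        by-cases (yes x∈) = subst (λ y → adj Γ x y ≡ true) (sym (orbitCycle-∈ x∈)) (σ-edges x (σ-moves-L x∈))
        by-cases (no  x∉) = ⊥-elim (moved (cycle-∉ L x∉))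

    rest-edges : FollowsEdges rest
    rest-edges x moved = by-cases (x ∈? L)
      where
        by-cases : Dec (x ∈ L) → adj Γ x (rest x) ≡ true
        by-cases (yes x∈) = ⊥-elim (moved (rest-∈ x∈))
        by-cases (no  x∉) = subst (λ y → adj Γ x y ≡ true) (sym (rest-∉ x∉)) (σ-edges x λ σx≡x → moved (trans (rest-∉ x∉) σx≡x))

    orbit-walk : Walk Γ a a period
    orbit-walk = subst (λ y → Walk Γ a y period) orbit-period (walkTo period ℕₚ.≤-refl)
      where
        walkTo : ∀ k → k ≤ period → Walk Γ a (orbit k) k
        walkTo zero    _   = ε
        walkTo (suc k) k<p = walkTo k (ℕₚ.<⇒≤ k<p) ▻ σ-edges (orbit k) (σ-moves-L (∈-applyUpTo⁺ orbit k<p))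

  noOddClosedWalk⇒evenSupports : NoOddClosedWalk Γ → EvenSupports
  noOddClosedWalk⇒evenSupports noOdd σ σ-inj σ-edges = <-rec P step (support σ) σ σ-inj σ-edges refl
    where
      P : ℕ → Set
      P s = ∀ σ → Injective _≡_ _≡_ σ → FollowsEdges σ → support σ ≡ s → parity s ≡ 0ℙ
      step : ∀ s → (∀ {s′} → s′ < s → P s′) → P s
      step zero    _       σ σ-inj σ-edges _  = refl
      step (suc s) smaller σ σ-inj σ-edges eq with support-moved σ (λ s≡0 → ℕₚ.1+n≢0 (trans (sym eq) s≡0))
      ... | a , σa≢a = begin
        parity (suc s)                         ≡⟨ cong parity (trans (sym eq) support-split) ⟩
        parity (period ℕ.+ support rest)       ≡⟨ Parityₚ.+-homo-+ period (support rest) ⟩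
        parity period ℙ.+ parity (support rest) ≡⟨ cong₂ ℙ._+_ (noOdd orbit-walk) (smaller rest<σ rest rest-injective rest-edges refl) ⟩
        0ℙ                                     ∎
        where
          open ≡-Reasoning
          open OrbitAlongEdges σ σ-inj σ-edges a σa≢a
          rest<σ : support rest < suc s
          rest<σ = subst (support rest <_) (trans (sym support-split) eq) (ℕₚ.m<n+m (support rest) (s≤s z≤n))

  evenSupports⇒noOddClosedWalk : EvenSupports → NoOddClosedWalk Γ
  evenSupports⇒noOddClosedWalk even p = <-rec P step _ p
    where
      P : ℕ → Set
      P k = ∀ {u} → Walk Γ u u k → parity k ≡ 0ℙ
      step : ∀ k → (∀ {k′} → k′ < k → P k′) → P k
      step zero    _       _          = refl
      step (suc k) shorter p@(_ ◅ _) with removeLoop p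
      ... | inj₁ unique = begin
        parity (suc k)                     ≡⟨ cong parity (trans (sym (length-vertices p)) (sym support-π)) ⟩
        parity (support π)                 ≡⟨ even π (cycle-injective unique) π-edges ⟩
        0ℙ                                 ∎
        where
          open ≡-Reasoning
          π = cycle (vertices p)
          π-adj : ∀ {x} → x ∈ vertices p → adj Γ x (π x) ≡ true
          π-adj = nextIn-chain (vertices p) (vertices-chain p)
          π-moves : ∀ {x} → x ∈ vertices p → π x ≢ x
          π-moves {x} x∈ πx≡x with () ← trans (sym (subst (λ y → adj Γ x y ≡ true) πx≡x (π-adj x∈))) (loopless Γ x)
          π-edges : FollowsEdges π
          π-edges x moved with x ∈? vertices p
          ... | yes x∈ = π-adj x∈
          ... | no  x∉ = ⊥-elim (moved (cycle-∉ (vertices p) x∉))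
          support-π : support π ≡ length (vertices p)
          support-π = support-≡-length π unique π-moves (cycle-∉ (vertices p))
      ... | inj₂ detour = begin
        parity (suc k)                              ≡⟨ parity-detour Γ splits ⟩
        parity (suc k₁) ℙ.+ parity (suc k₂)         ≡⟨ cong₂ ℙ._+_ (shorter k₁<k shortcut) (shorter k₂<k loop) ⟩
        0ℙ                                          ∎
        where
          open ≡-Reasoning
          open Detour detour
          k₁<k : suc k₁ < suc k
          k₁<k = subst (suc k₁ <_) splits (ℕₚ.m<m+n (suc k₁) (s≤s z≤n))
          k₂<k : suc k₂ < suc k
          k₂<k = subst (suc k₂ <_) splits (ℕₚ.m<n+m (suc k₂) (s≤s z≤n))

  sign-minimalOddSupport : ∀ σ → Injective _≡_ _≡_ σ → FollowsEdges σ → parity (support σ) ≡ 1ℙ →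
                           (∀ π → Injective _≡_ _≡_ π → FollowsEdges π → support π < support σ → parity (support π) ≡ 0ℙ) →
                           sign σ ≡ 1ℤ
  sign-minimalOddSupport σ σ-inj σ-edges odd smallerEven
    with support-moved σ (λ s≡0 → Parityₚ.p≢p⁻¹ 0ℙ (trans (sym (cong parity s≡0)) odd))
  ... | a , σa≢a with support rest ℕ.≟ 0
    where open OrbitAlongEdges σ σ-inj σ-edges a σa≢a
  ...   | yes rest-fixes = begin
    sign σ                               ≡⟨ sign-cong σ≗cycle ⟩
    sign (cycle L)                       ≡⟨ sign-cycle L-unique ⟩
    -1ℤ ℤ.^ length (applyUpTo (orbit ∘ suc) (ℕ.pred period)) ≡⟨ cong (-1ℤ ℤ.^_) (length-applyUpTo (orbit ∘ suc) (ℕ.pred period)) ⟩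
    -1ℤ ℤ.^ ℕ.pred period               ≡⟨ -1^-even (ℕ.pred period) (sym (Parityₚ.⁻¹-selfInverse (trans (sym (parity-suc (ℕ.pred period))) period-odd))) ⟩
    1ℤ                                   ∎
    where
      open ≡-Reasoning
      open OrbitAlongEdges σ σ-inj σ-edges a σa≢a
      period-odd : parity period ≡ 1ℙ
      period-odd = trans (cong parity (sym (trans support-split (trans (cong (period ℕ.+_) rest-fixes) (ℕₚ.+-identityʳ period))))) odd
      σ≗cycle : ∀ x → σ x ≡ cycle L x
      σ≗cycle x with x ∈? L
      ... | yes x∈ = sym (orbitCycle-∈ x∈)
      ... | no  x∉ = trans (sym (rest-∉ x∉)) (trans (support≡0 rest rest-fixes x) (sym (cycle-∉ L x∉)))
  ...   | no  rest-moves = ⊥-elim (Parityₚ.p≢p⁻¹ 0ℙ (trans (sym even) odd))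
    where
      open OrbitAlongEdges σ σ-inj σ-edges a σa≢a
      even : parity (support σ) ≡ 0ℙ
      even = begin
        parity (support σ)                       ≡⟨ cong parity support-split ⟩
        parity (period ℕ.+ support rest)         ≡⟨ Parityₚ.+-homo-+ period (support rest) ⟩
        parity period ℙ.+ parity (support rest)  ≡⟨ cong₂ ℙ._+_ period-even rest-even ⟩
        0ℙ                                       ∎
        where
          open ≡-Reasoning
          period-even : parity period ≡ 0ℙ
          period-even = subst (λ s → parity s ≡ 0ℙ) support-orbitCycle
            (smallerEven orbitCycle (cycle-injective L-unique) orbitCycle-edges
              (subst₂ _<_ (sym support-orbitCycle) (sym support-split) (ℕₚ.m<m+n period (ℕₚ.n≢0⇒n>0 rest-moves))))
          rest-even : parity (support rest) ≡ 0ℙ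
          rest-even = smallerEven rest rest-injective rest-edges
            (subst (support rest <_) (sym support-split) (ℕₚ.m<n+m (support rest) (s≤s z≤n)))

  adjMat-zero-diagonal : ∀ u → adjMat Γ u u ≡ 0ℤ
  adjMat-zero-diagonal u rewrite loopless Γ u = refl

  open Leibniz (adjMat Γ) adjMat-zero-diagonal

  followsEdges? : ∀ π → Dec (FollowsEdges π)
  followsEdges? π = Finₚ.all? λ i → ¬? (π i ≟ i) →-dec (adj Γ i (π i) Boolₚ.≟ true)

  FollowsEdges-cong : ∀ {π π′} → (∀ i → π i ≡ π′ i) → FollowsEdges π → FollowsEdges π′
  FollowsEdges-cong π≗π′ edges i moved =
    subst (λ y → adj Γ i y ≡ true) (π≗π′ i) (edges i (moved ∘ trans (sym (π≗π′ i))))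

  weights : (Fin K → Fin K) → ℤ
  weights π = prodℤ λ i → weight i (π i)

  weights-edges : ∀ {π} → FollowsEdges π → weights π ≡ -1ℤ ℤ.^ support π
  weights-edges {π} edges = trans (prodℤ-cong weight-sign) (prodℤ-signs (isFixed π))
    where
      prodℤ-cong : ∀ {n} {f g : Fin n → ℤ} → (∀ i → f i ≡ g i) → prodℤ f ≡ prodℤ g
      prodℤ-cong {zero}  f≗g = refl
      prodℤ-cong {suc n} f≗g = cong₂ ℤ._*_ (f≗g zero) (prodℤ-cong (f≗g ∘ suc))
      weight-sign : ∀ i → weight i (π i) ≡ (if isFixed π i then 1ℤ else -1ℤ)
      weight-sign i with i ≟ π i
      ... | yes _ = refl
      ... | no  i≢πi rewrite edges i (i≢πi ∘ sym) = refl

  weights-nonEdge : ∀ {π} → ¬ FollowsEdges π → weights π ≡ 0ℤ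
  weights-nonEdge {π} ¬edges with Finₚ.¬∀⟶∃¬ K _ (λ i → ¬? (π i ≟ i) →-dec (adj Γ i (π i) Boolₚ.≟ true)) ¬edges
  ... | i , ¬edge = prodℤ-zero _ i weight≡0
    where
      weight≡0 : weight i (π i) ≡ 0ℤ
      weight≡0 with i ≟ π i
      ... | yes i≡πi = ⊥-elim (¬edge λ moved → ⊥-elim (moved (sym i≡πi)))
      ... | no  _ with adj Γ i (π i)
      ...   | true  = ⊥-elim (¬edge λ _ → refl)
      ...   | false = refl

  fixed+support : ∀ π → count (isFixed π) ℕ.+ support π ≡ K
  fixed+support π = count-complement (isFixed π)

  term-edges : ∀ {m} c → FollowsEdges (decode c) → support (decode c) ≡ m →
               term id id (K ℕ.∸ m) c ≡ codeSign c ℤ.* -1ℤ ℤ.^ m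
  term-edges {m} c edges refl = cong (codeSign c ℤ.*_) (begin
    weights (decode c) ℤ.* δ (K ℕ.∸ m) (count (isFixed (decode c)))  ≡⟨ cong₂ (λ w f → w ℤ.* δ (K ℕ.∸ m) f) (weights-edges edges) fixed≡ ⟩
    -1ℤ ℤ.^ m ℤ.* δ (K ℕ.∸ m) (K ℕ.∸ m)                               ≡⟨ cong (-1ℤ ℤ.^ m ℤ.*_) (δ-refl (K ℕ.∸ m)) ⟩
    -1ℤ ℤ.^ m ℤ.* 1ℤ                                                  ≡⟨ ℤₚ.*-identityʳ _ ⟩
    -1ℤ ℤ.^ m                                                         ∎)
    where
      open ≡-Reasoning
      fixed≡ : count (isFixed (decode c)) ≡ K ℕ.∸ m
      fixed≡ = trans (sym (ℕₚ.m+n∸n≡m _ m)) (cong (ℕ._∸ m) (fixed+support (decode c)))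

  term-vanishes : ∀ {m} c → m ≤ K → ¬ (FollowsEdges (decode c) × support (decode c) ≡ m) → term id id (K ℕ.∸ m) c ≡ 0ℤ
  term-vanishes {m} c m≤K ¬good with followsEdges? (decode c)
  ... | no ¬edges rewrite weights-nonEdge ¬edges = ℤₚ.*-zeroʳ (codeSign c)
  ... | yes edges = trans (cong (λ d → codeSign c ℤ.* (weights (decode c) ℤ.* d)) (δ-≢ fixed≢))
                     (trans (cong (codeSign c ℤ.*_) (ℤₚ.*-zeroʳ (weights (decode c)))) (ℤₚ.*-zeroʳ (codeSign c)))
    where
      fixed≢ : K ℕ.∸ m ≢ count (isFixed (decode c))
      fixed≢ eq = ¬good (edges , ℕₚ.+-cancelˡ-≡ (count (isFixed (decode c))) _ _
        (trans (fixed+support (decode c)) (trans (sym (ℕₚ.m∸n+n≡m m≤K)) (cong (ℕ._+ m) eq))))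

  OddCoefficientsVanish : Set
  OddCoefficientsVanish = ∀ m → m ≤ K → parity m ≡ 1ℙ → coeff (charPoly (adjMat Γ)) (K ℕ.∸ m) ≡ 0ℤ

  evenSupports⇒oddCoefficientsVanish : EvenSupports → OddCoefficientsVanish
  evenSupports⇒oddCoefficientsVanish even m m≤K odd =
    trans (coeff-charPoly (K ℕ.∸ m)) (sumCode-zero _ λ c → term-vanishes c m≤K λ (edges , support≡m) →
      Parityₚ.p≢p⁻¹ 0ℙ (trans (sym (trans (cong parity (sym support≡m)) (even (decode c) (decode-injective c) edges))) odd))

  -- A least odd support forces every term of that coefficient to be -1.
  oddCoefficientsVanish⇒evenSupports : OddCoefficientsVanish → EvenSupports
  oddCoefficientsVanish⇒evenSupports vanish σ σ-inj σ-edges = <-rec P step (support σ) σ σ-inj σ-edges refl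
    where
      P : ℕ → Set
      P s = ∀ σ → Injective _≡_ _≡_ σ → FollowsEdges σ → support σ ≡ s → parity s ≡ 0ℙ
      step : ∀ s → (∀ {s′} → s′ < s → P s′) → P s
      step s smallerEven σ σ-inj σ-edges refl with parity s in parity-s
      ... | 0ℙ = refl
      ... | 1ℙ = ⊥-elim (ℤₚ.<-irrefl coefficient≡0 coefficient<0)
        where
          s≤K : s ≤ K
          s≤K = count≤ (not ∘ isFixed σ)
          term-good : ∀ c → FollowsEdges (decode c) → support (decode c) ≡ s → term id id (K ℕ.∸ s) c ≡ -1ℤ
          term-good c edges support≡s = begin
            term id id (K ℕ.∸ s) c  ≡⟨ term-edges c edges support≡s ⟩
            codeSign c ℤ.* -1ℤ ℤ.^ s ≡⟨ cong₂ ℤ._*_ (trans (sym (sign-decode c)) sign≡1) (-1^-odd s parity-s) ⟩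
            1ℤ ℤ.* -1ℤ               ≡⟨⟩
            -1ℤ                      ∎
            where
              open ≡-Reasoning
              sign≡1 : sign (decode c) ≡ 1ℤ
              sign≡1 = sign-minimalOddSupport (decode c) (decode-injective c) edges (trans (cong parity support≡s) parity-s)
                λ π π-inj π-edges smaller → smallerEven (subst (support π <_) support≡s smaller) π π-inj π-edges refl
          term≤0 : ∀ c → term id id (K ℕ.∸ s) c ℤ.≤ 0ℤ
          term≤0 c with followsEdges? (decode c) | support (decode c) ℕ.≟ s
          ... | yes edges  | yes support≡s = ℤₚ.≤-trans (ℤₚ.≤-reflexive (term-good c edges support≡s)) ℤ.-≤+
          ... | yes _      | no  support≢s = ℤₚ.≤-reflexive (term-vanishes c s≤K (support≢s ∘ proj₂))
          ... | no  ¬edges | _             = ℤₚ.≤-reflexive (term-vanishes c s≤K (¬edges ∘ proj₁))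
          c₀ = proj₁ (encode σ σ-inj)
          decode≗σ = proj₂ (encode σ σ-inj)
          coefficient<0 : coeff (charPoly (adjMat Γ)) (K ℕ.∸ s) ℤ.< 0ℤ
          coefficient<0 = subst (ℤ._< 0ℤ) (sym (coeff-charPoly (K ℕ.∸ s))) (sumCode-negative _ term≤0 c₀
            (ℤₚ.≤-<-trans (ℤₚ.≤-reflexive (term-good c₀ (FollowsEdges-cong (sym ∘ decode≗σ) σ-edges) (support-cong decode≗σ))) ℤ.-<+))
          coefficient≡0 : coeff (charPoly (adjMat Γ)) (K ℕ.∸ s) ≡ 0ℤ
          coefficient≡0 = vanish s s≤K parity-s

  bipartite⇒oddCoefficientsVanish : Bipartite Γ → OddCoefficientsVanish
  bipartite⇒oddCoefficientsVanish =
    evenSupports⇒oddCoefficientsVanish ∘ noOddClosedWalk⇒evenSupports ∘ bipartite⇒noOddClosedWalk Γ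

  oddCoefficientsVanish⇒bipartite : OddCoefficientsVanish → Bipartite Γ
  oddCoefficientsVanish⇒bipartite =
    noOddClosedWalk⇒bipartite Γ ∘ evenSupports⇒noOddClosedWalk ∘ oddCoefficientsVanish⇒evenSupports

module _ {n} (F : Graph n) where

  swapBlocks : Fin (n ℕ.+ n) → Fin (n ℕ.+ n)
  swapBlocks i = join n n (Sum.swap (splitAt n i))

  swapBlocks-↑ˡ : ∀ a → swapBlocks (a ↑ˡ n) ≡ n ↑ʳ a
  swapBlocks-↑ˡ a = cong (join n n ∘ Sum.swap) (splitAt-↑ˡ n a n)

  swapBlocks-↑ʳ : ∀ a → swapBlocks (n ↑ʳ a) ≡ a ↑ˡ n
  swapBlocks-↑ʳ a = cong (join n n ∘ Sum.swap) (splitAt-↑ʳ n n a)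

  sumℤ-swapBlocks : (f : Fin (n ℕ.+ n) → ℤ) → sumℤ (f ∘ swapBlocks) ≡ sumℤ f
  sumℤ-swapBlocks f = begin
    sumℤ (f ∘ swapBlocks)                                                     ≡⟨ sumℤ-++ n n (f ∘ swapBlocks) ⟩
    sumℤ (λ a → f (swapBlocks (a ↑ˡ n))) ℤ.+ sumℤ (λ a → f (swapBlocks (n ↑ʳ a))) ≡⟨ cong₂ ℤ._+_ (sumℤ-cong (cong f ∘ swapBlocks-↑ˡ)) (sumℤ-cong (cong f ∘ swapBlocks-↑ʳ)) ⟩
    sumℤ (λ a → f (n ↑ʳ a)) ℤ.+ sumℤ (λ a → f (a ↑ˡ n))                       ≡⟨ ℤₚ.+-comm (sumℤ (λ a → f (n ↑ʳ a))) _ ⟩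
    sumℤ (λ a → f (a ↑ˡ n)) ℤ.+ sumℤ (λ a → f (n ↑ʳ a))                       ≡⟨ sumℤ-++ n n f ⟨
    sumℤ f                                                                    ∎
    where open ≡-Reasoning

  adj-H≡adj-G-swapBlocks : ∀ i j → adj H[ F ] i j ≡ adj G[ F ] (swapBlocks i) j
  adj-H≡adj-G-swapBlocks i j rewrite splitAt-join n n (Sum.swap (splitAt n i)) with splitAt n i | splitAt n j
  ... | inj₁ _ | inj₁ _ = refl
  ... | inj₁ _ | inj₂ _ = refl
  ... | inj₂ _ | inj₁ _ = refl
  ... | inj₂ _ | inj₂ _ = refl

  gram-H≡gram-G : ∀ i j → (transpose (adjMat H[ F ]) · adjMat H[ F ]) i j ≡ (transpose (adjMat G[ F ]) · adjMat G[ F ]) i j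
  gram-H≡gram-G i j = begin
    sumℤ (λ k → AH k i ℤ.* AH k j)                           ≡⟨ sumℤ-cong (λ k → cong₂ ℤ._*_ (entry-swap k i) (entry-swap k j)) ⟩
    sumℤ (λ k → AG (swapBlocks k) i ℤ.* AG (swapBlocks k) j) ≡⟨ sumℤ-swapBlocks (λ k → AG k i ℤ.* AG k j) ⟩
    sumℤ (λ k → AG k i ℤ.* AG k j)                           ∎
    where
      open ≡-Reasoning
      AG = adjMat G[ F ]
      AH = adjMat H[ F ]
      entry-swap : ∀ k l → AH k l ≡ AG (swapBlocks k) l
      entry-swap k l = cong (λ b → if b then 1ℤ else 0ℤ) (adj-H≡adj-G-swapBlocks k l)

  G-singularlyCospectral-H : SingularlyCospectral G[ F ] H[ F ]
  G-singularlyCospectral-H = 0 , 0 , λ k → cong (λ p → coeff (X^ 0 *P p) k) (sym (charPoly-cong gram-H≡gram-G))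

  G-bipartite : Bipartite G[ F ]
  G-bipartite = block , proper
    where
      block : Fin (n ℕ.+ n) → Bool
      block i = Sum.[ (λ _ → true) , (λ _ → false) ]′ (splitAt n i)
      proper : ∀ i j → adj G[ F ] i j ≡ true → block i ≢ block j
      proper i j e with splitAt n i | splitAt n j
      ... | inj₁ _ | inj₂ _ = λ ()
      ... | inj₂ _ | inj₁ _ = λ ()

  H-bipartite⇒bipartite : Bipartite H[ F ] → Bipartite F
  H-bipartite⇒bipartite (c , proper) = c ∘ (_↑ˡ n) , λ a b e → proper (a ↑ˡ n) (b ↑ˡ n) (trans (adj-left a b) e)
    where
      adj-left : ∀ a b → adj H[ F ] (a ↑ˡ n) (b ↑ˡ n) ≡ adj F a b
      adj-left a b rewrite splitAt-↑ˡ n a n | splitAt-↑ˡ n b n = refl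

theorem4p1 : ∀ {n : ℕ} (F : Graph n) → 3 ≤ n → NonBipartite F
    → NCSC G[ F ] H[ F ]
theorem4p1 F _ nonBipartite = G-singularlyCospectral-H F , λ cospectral →
  nonBipartite (H-bipartite⇒bipartite F (oddCoefficientsVanish⇒bipartite H[ F ] λ m m≤ odd →
    trans (sym (cospectral _)) (bipartite⇒oddCoefficientsVanish G[ F ] (G-bipartite F) m m≤ odd)))
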